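{- Let $n_1, n_2 \ge 1$ with $n_1 n_2 \ge 2$, let $G$ be the unweighted $n_1 \times n_2$ grid graph, and let $T$ be the special spanning tree of $G$ described in the context. Then the average stretch $\mathrm{st}(T)/m$ of $T$, where $m$ is the number of edges of $G$, is $$\mathcal{O}\!\left(\frac{(n_1+n_2)^2 \log(n_1+n_2)}{n_1 n_2}\right),$$ i.e. there is an absolute constant $C>0$ such that $\mathrm{st}(T)/m \le C\,\frac{(n_1+n_2)^2\log(n_1+n_2)}{n_1 n_2}$ for all such $n_1,n_2$.
   Context: The $n_1\times n_2$ grid graph has vertex set $\{1,\dots,n_1\}\times\{1,\dots,n_2\}$, with an edge between two vertices iff they differ by exactly $1$ in exactly one coordinate; all edge weights are $1$. For a spanning tree $T$ of a graph $G=(V,E)$ with edge weights $w$, and an edge $e=uv\in E$, the stretch is $\mathrm{st}(e)=\bigl(\sum_{e'\in P_T(u,v)} w_{e'}\bigr)/w_e$, where $P_T(u,v)$ is the unique $u$–$v$ path in $T$ (for the unweighted grid this is the number of edges on the tree path); the stretch of $T$ is $\mathrm{st}(T)=\sum_{e\in E}\mathrm{st}(e)$, and the average stretch is $\mathrm{st}(T)/|E|$. The special spanning tree is built recursively: the $n_1\times n_2$ grid is subdivided into four subgrids (by splitting the rows and the columns each into two halves as evenly as possible), a special spanning tree is built recursively in each of the four subgrids (a grid with a single row or column being a path, which is its own spanning tree), and the four subtrees are connected into one spanning tree by three grid edges crossing the two dividing lines at the middle of the grid, forming a U-shape (e.g. joining the top-left subgrid to the bottom-left one, the bottom-left to the bottom-right,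 and the bottom-right to the top-right, using edges adjacent to the centre of the grid). -}

module Defs where

open import Data.Nat using (ℕ; zero; suc; _+_; _*_; _∸_; ⌊_/2⌋)
open import Data.Product using (_×_; _,_; proj₁; proj₂)
open import Data.Sum using (_⊎_)
open import Data.List using (List; []; _∷_; _++_; map; concatMap; length; upTo)
open import Data.List.Membership.Propositional using (_∈_)
open import Data.List.Relation.Unary.All using (All; []; _∷_)
open import Data.List.Relation.Unary.Unique.Propositional using (Unique)

-- Vertices of the grid: pairs (i , j), with 1 ≤ i ≤ n₁ (row), 1 ≤ j ≤ n₂ (column).
V : Set
V = ℕ × ℕ

Edge : Set
Edge = V × V

gridEdges : ℕ → ℕ → List Edge
gridEdges n₁ n₂ =
  concatMap (λ i → map (λ j → ((suc i , suc j) , (suc (suc i) , suc j))) (upTo n₂)) (upTo (n₁ ∸ 1))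
  ++ concatMap (λ i → map (λ j → ((suc i , suc j) , (suc i , suc (suc j)))) (upTo (n₂ ∸ 1))) (upTo n₁)

-- Special spanning tree of the subgrid with rows r₀+1 … r₀+a and columns
-- c₀+1 … c₀+b (a, b ≥ 1).  The first argument is recursion fuel; fuel a + b
-- always suffices since every recursive call strictly decreases a + b.
-- * single row (a = 1) or single column (b = 1): the path itself;
-- * otherwise split rows into a₁ = ⌊a/2⌋ (top) and a - a₁ (bottom) and columns
--   into b₁ = ⌊b/2⌋ (left) and b - b₁ (right), recurse in the four quadrants,
--   and join them by the U-shape of three edges around the centre:
--   TL–BL: (r₀+a₁ , c₀+b₁) – (r₀+a₁+1 , c₀+b₁)
--   BL–BR: (r₀+a₁+1 , c₀+b₁) – (r₀+a₁+1 , c₀+b₁+1)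
--   BR–TR: (r₀+a₁+1 , c₀+b₁+1) – (r₀+a₁ , c₀+b₁+1)
specialTreeF : ℕ → ℕ → ℕ → ℕ → ℕ → List Edge
specialTreeF zero r₀ c₀ a b = []
specialTreeF (suc f) r₀ c₀ a (suc zero) =
  map (λ i → ((r₀ + suc i , suc c₀) , (r₀ + suc (suc i) , suc c₀))) (upTo (a ∸ 1))
specialTreeF (suc f) r₀ c₀ (suc zero) b =
  map (λ j → ((suc r₀ , c₀ + suc j) , (suc r₀ , c₀ + suc (suc j)))) (upTo (b ∸ 1))
specialTreeF (suc f) r₀ c₀ a b =
  let a₁ = ⌊ a /2⌋
      a₂ = a ∸ a₁
      b₁ = ⌊ b /2⌋
      b₂ = b ∸ b₁
      r = r₀ + a₁
      c = c₀ + b₁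
  in  specialTreeF f r₀ c₀ a₁ b₁
   ++ specialTreeF f r  c₀ a₂ b₁
   ++ specialTreeF f r  c  a₂ b₂
   ++ specialTreeF f r₀ c  a₁ b₂
   ++ (((r , c) , (suc r , c))
      ∷ ((suc r , c) , (suc r , suc c))
      ∷ ((suc r , suc c) , (r , suc c))
      ∷ [])

specialTree : ℕ → ℕ → List Edge
specialTree n₁ n₂ = specialTreeF (n₁ + n₂) 0 0 n₁ n₂

Adj : List Edge → V → V → Set
Adj es u v = ((u , v) ∈ es) ⊎ ((v , u) ∈ es)

data Walk (R : V → V → Set) : V → V → List V → Set where
  stop : ∀ {u} → Walk R u u (u ∷ [])
  step : ∀ {u w v vs} → R u w → Walk R w v vs → Walk R u v (u ∷ vs)

record Path (es : List Edge) (u v : V) : Set where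
  constructor path
  field
    verts  : List V
    walk   : Walk (Adj es) u v verts
    simple : Unique verts

pathLength : ∀ {es u v} → Path es u v → ℕ
pathLength p = length (Path.verts p) ∸ 1

-- A choice, for every edge uv of the graph with edge list gs, of a u–v path in
-- the tree with edge list ts.  (In a tree such paths exist and are unique.)
TreePaths : List Edge → List Edge → Set
TreePaths ts gs = All (λ e → Path ts (proj₁ e) (proj₂ e)) gs

totalStretch : ∀ {ts gs} → TreePaths ts gs → ℕ
totalStretch []       = 0
totalStretch (p ∷ ps) = pathLength p + totalStretch ps

GridTreePaths : ℕ → ℕ → Set
GridTreePaths n₁ n₂ = TreePaths (specialTree n₁ n₂) (gridEdges n₁ n₂)

-- Every block of the recursion carries a tree in which a simple path between two of its vertices
-- has at most 4(a + b − 2) − 3 edges: gluing the four quadrant trees by the U of three edges at most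
-- doubles this bound and adds three, while a + b − 2 at least halves from a block to its quadrants.
-- A grid edge inside one quadrant is stretched as in that quadrant's tree, and each of the a + b
-- edges crossing the two middle lines is stretched by at most the diameter of the block, so the total
-- stretch S of an a × b block satisfies S ≤ Σ S(quadrants) + 4(a + b)². The squared sizes of the
-- quadrants add up to at most (a + b)² + 2, so over the ⌊log₂(a + b − 2)⌋ + 1 levels of the recursion
-- S ≤ 8(n₁ + n₂)²(⌊log₂(n₁ + n₂ − 2)⌋ + 1) ≤ 16(n₁ + n₂)² ⌊log₂(n₁ + n₂)⌋, while the grid has at
-- least n₁n₂/2 edges. The bounds are on all simple walks, hence on whatever tree paths are supplied.

module Submission where

open import Defs
open import Data.Bool using (Bool; true; false; _∨_; if_then_else_)
open import Data.Empty using (⊥; ⊥-elim)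
open import Data.Nat using (ℕ; zero; suc; _+_; _*_; _∸_; _^_; _≤_; _<_; z≤n; s≤s; ⌊_/2⌋; ⌈_/2⌉; _≤ᵇ_; _≡ᵇ_; >-nonZero)
open import Data.Nat.Properties
open import Data.Nat.ListAction using (sum)
open import Data.Nat.ListAction.Properties using (sum-++)
open import Data.Nat.Logarithm using (⌊log₂_⌋; ⌊log₂⌋-mono-≤; ⌊log₂⌊n/2⌋⌋≡⌊log₂n⌋∸1; ⌊log₂[2^n]⌋≡n)
open import Data.Nat.Tactic.RingSolver using (solve-∀)
open import Data.Product using (_×_; ∃-syntax; _,_; proj₁; proj₂)
import Data.Product as Product
open import Data.Product.Properties using (≡-dec)
open import Data.Sum using (_⊎_; inj₁; inj₂; [_,_]) renaming (swap to swap⊎)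
import Data.Sum as Sum
open import Data.List using (List; []; _∷_; _++_; map; concatMap; length; upTo; applyUpTo)
open import Data.List.Properties using (length-++; length-map; length-upTo; map-++; map-upTo)
open import Data.List.Relation.Unary.All using (All; []; _∷_)
import Data.List.Relation.Unary.All as All
import Data.List.Relation.Unary.All.Properties as All
open import Data.List.Relation.Unary.Any using (here; there)
open import Data.List.Relation.Unary.Unique.Propositional using (Unique; []; _∷_)
open import Data.List.Membership.Propositional using (_∈_)
open import Data.List.Relation.Binary.Subset.Propositional using (_⊆_)
open import Data.List.Membership.Propositional.Properties
  using (∈-∃++; ∈-++⁻; ∈-++⁺ˡ; ∈-++⁺ʳ; ∈-map⁻; ∈-map⁺; ∈-upTo⁻; ∈-upTo⁺)
open import Function using (_∘_; id)
open import Relation.Binary.PropositionalEquality using (_≡_; _≢_; refl; sym; trans; cong; cong₂; subst; module ≡-Reasoning)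
open import Relation.Nullary using (Dec; yes; no)
open import Relation.Nullary.Decidable using (dec-true; dec-false)
open import Relation.Nullary.Reflects using (ofʸ; ofⁿ)

_≟V_ : (u v : V) → Dec (u ≡ v)
_≟V_ = ≡-dec _≟_ _≟_

open import Data.List.Membership.DecPropositional _≟V_ using (_∈?_)

-- Walks and simple paths

Graph : Set₁
Graph = V → V → Set

PathBound : Graph → V → V → ℕ → Set
PathBound R u v n = ∀ {vs} → Walk R u v vs → Unique vs → length vs ≤ suc n

Reachable : Graph → V → V → Set
Reachable R u v = ∃[ vs ] Walk R u v vs

walk-map : ∀ {R R′ : Graph} → (∀ {a b} → R a b → R′ a b) →
           ∀ {u v vs} → Walk R u v vs → Walk R′ u v vs
walk-map f stop       = stop
walk-map f (step r w) = step (f r) (walk-map f w)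

Reachable-map : ∀ {R R′ : Graph} → (∀ {a b} → R a b → R′ a b) →
                ∀ {u v} → Reachable R u v → Reachable R′ u v
Reachable-map f (vs , w) = vs , walk-map f w

module _ {R : Graph} where

  head∈walk : ∀ {u v vs} → Walk R u v vs → u ∈ vs
  head∈walk stop       = here refl
  head∈walk (step _ _) = here refl

  last∈walk : ∀ {u v vs} → Walk R u v vs → v ∈ vs
  last∈walk stop       = here refl
  last∈walk (step _ w) = there (last∈walk w)

  walk-All : ∀ {S : V → Set} → (∀ {a b} → R a b → S a × S b) →
             ∀ {u v vs} → S u → Walk R u v vs → All S vs
  walk-All closed su stop       = su ∷ []
  walk-All closed su (step r w) = su ∷ walk-All closed (proj₂ (closed r)) w

  edge : ∀ {u v} → R u v → Reachable R u v
  edge r = _ , step r stop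

  infixr 5 _◅◅_
  _◅◅_ : ∀ {u w v} → Reachable R u w → Reachable R w v → Reachable R u v
  (_ , stop)     ◅◅ c = c
  (_ , step r w) ◅◅ c = _ , step r (proj₂ ((_ , w) ◅◅ c))

  PathBound-mono : ∀ {u v m n} → m ≤ n → PathBound R u v m → PathBound R u v n
  PathBound-mono m≤n b w uq = ≤-trans (b w uq) (s≤s m≤n)

  PathBound-refl : ∀ {u} → PathBound R u u 0
  PathBound-refl stop       _          = ≤-refl
  PathBound-refl (step _ w) (u∉ ∷ _) = ⊥-elim (All.All¬⇒¬Any u∉ (last∈walk w))

  PathBound-map : ∀ {R′ : Graph} → (∀ {a b} → R′ a b → R a b) →
                  ∀ {u v n} → PathBound R u v n → PathBound R′ u v n
  PathBound-map f b w = b (walk-map f w)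

Unique-++⁻ˡ : ∀ (xs : List V) {ys} → Unique (xs ++ ys) → Unique xs
Unique-++⁻ˡ []       _         = []
Unique-++⁻ˡ (x ∷ xs) (x∉ ∷ uq) = All.++⁻ˡ xs x∉ ∷ Unique-++⁻ˡ xs uq

Unique-++⁻ʳ : ∀ (xs : List V) {ys} → Unique (xs ++ ys) → Unique ys
Unique-++⁻ʳ []       uq       = uq
Unique-++⁻ʳ (x ∷ xs) (_ ∷ uq) = Unique-++⁻ʳ xs uq

module _ {R : Graph} where

  private
    suffix : ∀ pre {w v u post} → Walk R w v (pre ++ u ∷ post) → Walk R u v (u ∷ post)
    suffix []            stop                = stop
    suffix []            (step r w)          = step r w
    suffix (_ ∷ [])      (step _ stop)       = stop
    suffix (_ ∷ [])      (step _ (step r w)) = step r w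
    suffix (_ ∷ p ∷ pre) (step _ w)          = suffix (p ∷ pre) w

  loop-erase : ∀ {u v vs} → Walk R u v vs → ∃[ ws ] (Walk R u v ws × Unique ws)
  loop-erase stop = _ , stop , [] ∷ []
  loop-erase {u} (step r w) with loop-erase w
  ... | ws , w′ , uq with u ∈? ws
  ...   | no  u∉ = u ∷ ws , step r w′ , All.¬Any⇒All¬ ws u∉ ∷ uq
  ...   | yes u∈ with ∈-∃++ u∈
  ...     | pre , post , refl = u ∷ post , suffix pre w′ , Unique-++⁻ʳ pre uq

Reachable⇒Path : ∀ {es u v} → Reachable (Adj es) u v → Path es u v
Reachable⇒Path (_ , w) with loop-erase w
... | ws , w′ , uq = path ws w′ uq

Adj-sym : ∀ {es u v} → Adj es u v → Adj es v u
Adj-sym (inj₁ e) = inj₂ e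
Adj-sym (inj₂ e) = inj₁ e

Reachable-sym : ∀ {es u v} → Reachable (Adj es) u v → Reachable (Adj es) v u
Reachable-sym (_ , stop)     = _ , stop
Reachable-sym (_ , step r w) = Reachable-sym (_ , w) ◅◅ edge (Adj-sym r)

PathBound⇒pathLength≤ : ∀ {es u v n} → PathBound (Adj es) u v n → (p : Path es u v) → pathLength p ≤ n
PathBound⇒pathLength≤ b (path vs w uq) = ∸-monoˡ-≤ 1 (b w uq)

Unique⊆⇒length≤ : ∀ {xs : List V} ys → Unique xs → xs ⊆ ys → length xs ≤ length ys
Unique⊆⇒length≤ {[]}     ys _          _   = z≤n
Unique⊆⇒length≤ {x ∷ xs} ys (x∉ ∷ uq) sub with ∈-∃++ (sub (here refl))
... | p , q , refl = begin
  suc (length xs)        ≤⟨ s≤s (Unique⊆⇒length≤ (p ++ q) uq (λ z∈ → drop-x (sub (there z∈)) (All.lookup x∉ z∈ ∘ sym))) ⟩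
  suc (length (p ++ q))  ≡⟨ cong suc (length-++ p) ⟩
  suc (length p + length q) ≡⟨ sym (+-suc (length p) (length q)) ⟩
  length p + length (x ∷ q) ≡⟨ sym (length-++ p) ⟩
  length (p ++ x ∷ q)    ∎
  where
  open ≤-Reasoning
  drop-x : ∀ {z} → z ∈ p ++ x ∷ q → z ≢ x → z ∈ p ++ q
  drop-x z∈ z≢x with ∈-++⁻ p z∈
  ... | inj₁ z∈p         = ∈-++⁺ˡ z∈p
  ... | inj₂ (here z≡x)  = ⊥-elim (z≢x z≡x)
  ... | inj₂ (there z∈q) = ∈-++⁺ʳ p z∈q

Link : V → V → Graph
Link x y a b = (a ≡ x × b ≡ y) ⊎ (a ≡ y × b ≡ x)

Bridged : Graph → Graph → V → V → Graph
Bridged R₁ R₂ x y a b = R₁ a b ⊎ R₂ a b ⊎ Link x y a b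

-- A simple walk from one side to the other uses the bridge x – y exactly once, and one
-- between two vertices of the same side never leaves it.
module Bridge {R₁ R₂ : Graph} {S₁ S₂ : V → Set} (x y : V)
  (closed₁ : ∀ {a b} → R₁ a b → S₁ a × S₁ b)
  (closed₂ : ∀ {a b} → R₂ a b → S₂ a × S₂ b)
  (disjoint : ∀ {a} → S₁ a → S₂ a → ⊥)
  (x∈S₁ : S₁ x) (y∈S₂ : S₂ y) where

  R : Graph
  R = Bridged R₁ R₂ x y

  private
    pattern e₁ r = inj₁ r
    pattern e₂ r = inj₂ (inj₁ r)
    pattern xy = inj₂ (inj₂ (inj₁ (refl , refl)))
    pattern yx = inj₂ (inj₂ (inj₂ (refl , refl)))

  closed : ∀ {a b} → R a b → (S₁ a ⊎ S₂ a) × (S₁ b ⊎ S₂ b)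
  closed (e₁ r) = Product.map inj₁ inj₁ (closed₁ r)
  closed (e₂ r) = Product.map inj₂ inj₂ (closed₂ r)
  closed xy     = inj₁ x∈S₁ , inj₂ y∈S₂
  closed yx     = inj₂ y∈S₂ , inj₁ x∈S₁

  x∈crossing₂₁ : ∀ {u v vs} → Walk R u v vs → S₂ u → S₁ v → x ∈ vs
  x∈crossing₂₁ stop            s₂ s₁ = ⊥-elim (disjoint s₁ s₂)
  x∈crossing₂₁ (step (e₁ r) w) s₂ s₁ = ⊥-elim (disjoint (proj₁ (closed₁ r)) s₂)
  x∈crossing₂₁ (step (e₂ r) w) s₂ s₁ = there (x∈crossing₂₁ w (proj₂ (closed₂ r)) s₁)
  x∈crossing₂₁ (step xy w)     s₂ s₁ = ⊥-elim (disjoint x∈S₁ s₂)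
  x∈crossing₂₁ (step yx w)     s₂ s₁ = there (head∈walk w)

  y∈crossing₁₂ : ∀ {u v vs} → Walk R u v vs → S₁ u → S₂ v → y ∈ vs
  y∈crossing₁₂ stop            s₁ s₂ = ⊥-elim (disjoint s₁ s₂)
  y∈crossing₁₂ (step (e₁ r) w) s₁ s₂ = there (y∈crossing₁₂ w (proj₂ (closed₁ r)) s₂)
  y∈crossing₁₂ (step (e₂ r) w) s₁ s₂ = ⊥-elim (disjoint s₁ (proj₁ (closed₂ r)))
  y∈crossing₁₂ (step xy w)     s₁ s₂ = there (head∈walk w)
  y∈crossing₁₂ (step yx w)     s₁ s₂ = ⊥-elim (disjoint s₁ y∈S₂)

  confine₁ : ∀ {u v vs} → Walk R u v vs → Unique vs → S₁ u → S₁ v → Walk R₁ u v vs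
  confine₁ stop            _         _  _   = stop
  confine₁ (step (e₁ r) w) (_ ∷ uq)  s₁ s₁′ = step r (confine₁ w uq (proj₂ (closed₁ r)) s₁′)
  confine₁ (step (e₂ r) w) _         s₁ _   = ⊥-elim (disjoint s₁ (proj₁ (closed₂ r)))
  confine₁ (step xy w)     (x∉ ∷ _)  _  s₁′ = ⊥-elim (All.All¬⇒¬Any x∉ (x∈crossing₂₁ w y∈S₂ s₁′))
  confine₁ (step yx w)     _         s₁ _   = ⊥-elim (disjoint s₁ y∈S₂)

  confine₂ : ∀ {u v vs} → Walk R u v vs → Unique vs → S₂ u → S₂ v → Walk R₂ u v vs
  confine₂ stop            _         _  _   = stop
  confine₂ (step (e₁ r) w) _         s₂ _   = ⊥-elim (disjoint (proj₁ (closed₁ r)) s₂)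
  confine₂ (step (e₂ r) w) (_ ∷ uq)  s₂ s₂′ = step r (confine₂ w uq (proj₂ (closed₂ r)) s₂′)
  confine₂ (step xy w)     _         s₂ _   = ⊥-elim (disjoint x∈S₁ s₂)
  confine₂ (step yx w)     (y∉ ∷ _)  _  s₂′ = ⊥-elim (All.All¬⇒¬Any y∉ (y∈crossing₁₂ w x∈S₁ s₂′))

  split₁₂ : ∀ {u v vs} → Walk R u v vs → Unique vs → S₁ u → S₂ v →
            ∃[ vs₁ ] ∃[ vs₂ ] (vs ≡ vs₁ ++ vs₂) × Walk R₁ u x vs₁ × Walk R₂ y v vs₂
  split₁₂ stop            _        s₁ s₂ = ⊥-elim (disjoint s₁ s₂)
  split₁₂ (step (e₁ r) w) (_ ∷ uq) s₁ s₂ with split₁₂ w uq (proj₂ (closed₁ r)) s₂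
  ... | vs₁ , vs₂ , refl , w₁ , w₂ = _ ∷ vs₁ , vs₂ , refl , step r w₁ , w₂
  split₁₂ (step (e₂ r) w) _        s₁ _  = ⊥-elim (disjoint s₁ (proj₁ (closed₂ r)))
  split₁₂ (step xy w)     (_ ∷ uq) s₁ s₂ = _ , _ , refl , stop , confine₂ w uq y∈S₂ s₂
  split₁₂ (step yx w)     _        s₁ _  = ⊥-elim (disjoint s₁ y∈S₂)

  split₂₁ : ∀ {u v vs} → Walk R u v vs → Unique vs → S₂ u → S₁ v →
            ∃[ vs₁ ] ∃[ vs₂ ] (vs ≡ vs₁ ++ vs₂) × Walk R₂ u y vs₁ × Walk R₁ x v vs₂
  split₂₁ stop            _        s₂ s₁ = ⊥-elim (disjoint s₁ s₂)
  split₂₁ (step (e₁ r) w) _        s₂ _  = ⊥-elim (disjoint (proj₁ (closed₁ r)) s₂)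
  split₂₁ (step (e₂ r) w) (_ ∷ uq) s₂ s₁ with split₂₁ w uq (proj₂ (closed₂ r)) s₁
  ... | vs₁ , vs₂ , refl , w₁ , w₂ = _ ∷ vs₁ , vs₂ , refl , step r w₁ , w₂
  split₂₁ (step xy w)     _        s₂ _  = ⊥-elim (disjoint x∈S₁ s₂)
  split₂₁ (step yx w)     (_ ∷ uq) s₂ s₁ = _ , _ , refl , stop , confine₁ w uq x∈S₁ s₁

  private
    length-++-≤ : ∀ (vs₁ vs₂ : List V) {m n} → length vs₁ ≤ suc m → length vs₂ ≤ suc n →
                  length (vs₁ ++ vs₂) ≤ suc (m + suc n)
    length-++-≤ vs₁ vs₂ l₁ l₂ rewrite length-++ vs₁ {vs₂} = +-mono-≤ l₁ l₂

  bound₁₁ : ∀ {u v n} → S₁ u → S₁ v → PathBound R₁ u v n → PathBound R u v n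
  bound₁₁ s s′ b w uq = b (confine₁ w uq s s′) uq

  bound₂₂ : ∀ {u v n} → S₂ u → S₂ v → PathBound R₂ u v n → PathBound R u v n
  bound₂₂ s s′ b w uq = b (confine₂ w uq s s′) uq

  bound₁₂ : ∀ {u v m n} → S₁ u → S₂ v → PathBound R₁ u x m → PathBound R₂ y v n →
            PathBound R u v (m + suc n)
  bound₁₂ s s′ b₁ b₂ w uq with split₁₂ w uq s s′
  ... | vs₁ , vs₂ , refl , w₁ , w₂ =
    length-++-≤ vs₁ vs₂ (b₁ w₁ (Unique-++⁻ˡ vs₁ uq)) (b₂ w₂ (Unique-++⁻ʳ vs₁ uq))

  bound₂₁ : ∀ {u v m n} → S₂ u → S₁ v → PathBound R₂ u y m → PathBound R₁ x v n →
            PathBound R u v (m + suc n)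
  bound₂₁ s s′ b₁ b₂ w uq with split₂₁ w uq s s′
  ... | vs₁ , vs₂ , refl , w₁ , w₂ =
    length-++-≤ vs₁ vs₂ (b₁ w₁ (Unique-++⁻ˡ vs₁ uq)) (b₂ w₂ (Unique-++⁻ʳ vs₁ uq))

  reachable : (∀ {u v} → S₁ u → S₁ v → Reachable R₁ u v) → (∀ {u v} → S₂ u → S₂ v → Reachable R₂ u v) →
              ∀ {u v} → S₁ u ⊎ S₂ u → S₁ v ⊎ S₂ v → Reachable R u v
  reachable c₁ c₂ (inj₁ a) (inj₁ b) = Reachable-map e₁ (c₁ a b)
  reachable c₁ c₂ (inj₂ a) (inj₂ b) = Reachable-map e₂ (c₂ a b)
  reachable c₁ c₂ (inj₁ a) (inj₂ b) =
    reachable c₁ c₂ (inj₁ a) (inj₁ x∈S₁) ◅◅ edge xy ◅◅ reachable c₁ c₂ (inj₂ y∈S₂) (inj₂ b)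
  reachable c₁ c₂ (inj₂ a) (inj₁ b) =
    reachable c₁ c₂ (inj₂ a) (inj₂ y∈S₂) ◅◅ edge yx ◅◅ reachable c₁ c₂ (inj₁ x∈S₁) (inj₁ b)

<∸1⇒suc< : ∀ {i m} → i < m ∸ 1 → suc i < m
<∸1⇒suc< {m = suc _} i< = s≤s i<

suc<⇒<∸1 : ∀ {i m} → suc i < m → i < m ∸ 1
suc<⇒<∸1 {m = suc _} (s≤s i<) = i<

module Line (vtx : ℕ → V) (n : ℕ) (S : V → Set)
  (S⇒vtx : ∀ {z} → S z → ∃[ i ] (i < n × z ≡ vtx i))
  (vtx∈S : ∀ {i} → i < n → S (vtx i)) where

  edges : List Edge
  edges = map (λ i → vtx i , vtx (suc i)) (upTo (n ∸ 1))

  within : ∀ {u v} → Adj edges u v → S u × S v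
  within (inj₁ e) with ∈-map⁻ _ e
  ... | i , i∈ , refl = vtx∈S (<⇒≤ (<∸1⇒suc< (∈-upTo⁻ i∈))) , vtx∈S (<∸1⇒suc< (∈-upTo⁻ i∈))
  within (inj₂ e) with ∈-map⁻ _ e
  ... | i , i∈ , refl = vtx∈S (<∸1⇒suc< (∈-upTo⁻ i∈)) , vtx∈S (<⇒≤ (<∸1⇒suc< (∈-upTo⁻ i∈)))

  diameter : ∀ {u v} → S u → S v → PathBound (Adj edges) u v (n ∸ 1)
  diameter su sv {vs} w uq = begin
    length vs                 ≤⟨ Unique⊆⇒length≤ (map vtx (upTo n)) uq (enum (walk-All within su w)) ⟩
    length (map vtx (upTo n)) ≡⟨ trans (length-map vtx (upTo n)) (length-upTo n) ⟩
    n                         ≤⟨ m≤n+m∸n n 1 ⟩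
    suc (n ∸ 1)               ∎
    where
    open ≤-Reasoning
    enum : ∀ {xs} → All S xs → xs ⊆ map vtx (upTo n)
    enum ss z∈ with S⇒vtx (All.lookup ss z∈)
    ... | i , i< , refl = ∈-map⁺ vtx (∈-upTo⁺ i<)

  private
    toStart : ∀ i → i < n → Reachable (Adj edges) (vtx i) (vtx 0)
    toStart zero    _  = _ , stop
    toStart (suc i) i< =
      edge (inj₂ (∈-map⁺ _ (∈-upTo⁺ (suc<⇒<∸1 i<)))) ◅◅ toStart i (<⇒≤ i<)

  reachable : ∀ {u v} → S u → S v → Reachable (Adj edges) u v
  reachable su sv with S⇒vtx su | S⇒vtx sv
  ... | i , i< , refl | k , k< , refl = toStart i i< ◅◅ Reachable-sym (toStart k k<)

halves-sum : ∀ n → ⌊ n /2⌋ + (n ∸ ⌊ n /2⌋) ≡ n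
halves-sum n = m+[n∸m]≡n (⌊n/2⌋≤n n)

n∸⌊n/2⌋≡⌈n/2⌉ : ∀ n → n ∸ ⌊ n /2⌋ ≡ ⌈ n /2⌉
n∸⌊n/2⌋≡⌈n/2⌉ n = trans (cong (_∸ ⌊ n /2⌋) (sym (⌊n/2⌋+⌈n/2⌉≡n n))) (m+n∸m≡n ⌊ n /2⌋ ⌈ n /2⌉)

2*⌈n/2⌉≤1+n : ∀ n → 2 * ⌈ n /2⌉ ≤ suc n
2*⌈n/2⌉≤1+n zero          = z≤n
2*⌈n/2⌉≤1+n (suc zero)    = ≤-refl
2*⌈n/2⌉≤1+n (suc (suc n)) = s≤s (≤-trans (≤-reflexive (+-suc ⌈ n /2⌉ _)) (s≤s (2*⌈n/2⌉≤1+n n)))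

2*⌊n/2⌋≤n : ∀ n → 2 * ⌊ n /2⌋ ≤ n
2*⌊n/2⌋≤n zero          = z≤n
2*⌊n/2⌋≤n (suc zero)    = z≤n
2*⌊n/2⌋≤n (suc (suc n)) = s≤s (≤-trans (≤-reflexive (+-suc ⌊ n /2⌋ _)) (s≤s (2*⌊n/2⌋≤n n)))

2*⌊n/2⌋≤1+n : ∀ n → 2 * ⌊ n /2⌋ ≤ suc n
2*⌊n/2⌋≤1+n n = m≤n⇒m≤1+n (2*⌊n/2⌋≤n n)

2*[n∸⌊n/2⌋]≤1+n : ∀ n → 2 * (n ∸ ⌊ n /2⌋) ≤ suc n
2*[n∸⌊n/2⌋]≤1+n n = subst (λ h → 2 * h ≤ suc n) (sym (n∸⌊n/2⌋≡⌈n/2⌉ n)) (2*⌈n/2⌉≤1+n n)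

2*m≤n⇒m≤⌊n/2⌋ : ∀ {m n} → 2 * m ≤ n → m ≤ ⌊ n /2⌋
2*m≤n⇒m≤⌊n/2⌋ {m} {n} 2m≤n = subst (_≤ ⌊ n /2⌋) (sym (n≡⌊n+n/2⌋ m))
  (⌊n/2⌋-mono (subst (_≤ n) (cong (m +_) (+-identityʳ m)) 2m≤n))

⌊n/2⌋-pos : ∀ {n} → 2 ≤ n → 1 ≤ ⌊ n /2⌋
⌊n/2⌋-pos (s≤s (s≤s _)) = s≤s z≤n

n∸⌊n/2⌋-pos : ∀ {n} → 2 ≤ n → 1 ≤ n ∸ ⌊ n /2⌋
n∸⌊n/2⌋-pos {n} 2≤n = ≤-trans (⌊n/2⌋-pos 2≤n) (subst (⌊ n /2⌋ ≤_) (sym (n∸⌊n/2⌋≡⌈n/2⌉ n)) (⌊n/2⌋≤⌈n/2⌉ n))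

⌊n/2⌋-< : ∀ {n} → 2 ≤ n → ⌊ n /2⌋ < n
⌊n/2⌋-< {suc (suc n)} (s≤s (s≤s _)) = ⌊n/2⌋<n (suc n)

n∸⌊n/2⌋-< : ∀ {n} → 2 ≤ n → n ∸ ⌊ n /2⌋ < n
n∸⌊n/2⌋-< {n} 2≤n = ∸-monoʳ-< (⌊n/2⌋-pos 2≤n) (⌊n/2⌋≤n n)

-- Blocks and quadrants

record Block : Set where
  constructor block
  field
    row col height width : ℕ

open Block public

size : Block → ℕ
size B = height B + width B

tree : ℕ → Block → List Edge
tree f (block r c a b) = specialTreeF f r c a b

record Inside (B : Block) (v : V) : Set where
  constructor inside
  field
    row< : row B < proj₁ v
    row≤ : proj₁ v ≤ row B + height B
    col< : col B < proj₂ v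
    col≤ : proj₂ v ≤ col B + width B

data Quadrant : Set where
  tl bl br tr : Quadrant

_≟Q_ : (q q′ : Quadrant) → Dec (q ≡ q′)
tl ≟Q tl = yes refl
bl ≟Q bl = yes refl
br ≟Q br = yes refl
tr ≟Q tr = yes refl
tl ≟Q bl = no λ ()
tl ≟Q br = no λ ()
tl ≟Q tr = no λ ()
bl ≟Q tl = no λ ()
bl ≟Q br = no λ ()
bl ≟Q tr = no λ ()
br ≟Q tl = no λ ()
br ≟Q bl = no λ ()
br ≟Q tr = no λ ()
tr ≟Q tl = no λ ()
tr ≟Q bl = no λ ()
tr ≟Q br = no λ ()

-- The subdivision used by specialTreeF: the top rows and left columns get the smaller halves.
child : Quadrant → Block → Block
child tl (block r c a b) = block r c ⌊ a /2⌋ ⌊ b /2⌋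
child bl (block r c a b) = block (r + ⌊ a /2⌋) c (a ∸ ⌊ a /2⌋) ⌊ b /2⌋
child br (block r c a b) = block (r + ⌊ a /2⌋) (c + ⌊ b /2⌋) (a ∸ ⌊ a /2⌋) (b ∸ ⌊ b /2⌋)
child tr (block r c a b) = block r (c + ⌊ b /2⌋) ⌊ a /2⌋ (b ∸ ⌊ b /2⌋)

leftHalf rightHalf : Block → Block
leftHalf  (block r c a b) = block r c a ⌊ b /2⌋
rightHalf (block r c a b) = block r (c + ⌊ b /2⌋) a (b ∸ ⌊ b /2⌋)

midRow midCol : Block → ℕ
midRow B = row B + ⌊ height B /2⌋
midCol B = col B + ⌊ width B /2⌋

corner : Bool → Bool → Quadrant
corner true  true  = tl
corner false true  = bl
corner false false = br
corner true  false = tr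

quadrant : Block → V → Quadrant
quadrant B (i , j) = corner (i ≤ᵇ midRow B) (j ≤ᵇ midCol B)

-- The endpoints of the three edges joining the quadrants.
centre : Quadrant → Block → V
centre tl B = midRow B , midCol B
centre bl B = suc (midRow B) , midCol B
centre br B = suc (midRow B) , suc (midCol B)
centre tr B = midRow B , suc (midCol B)

private
  split-at : ∀ r {k h} → k ≤ h → r + h ≡ (r + k) + (h ∸ k)
  split-at r {k} k≤h = trans (cong (r +_) (sym (m+[n∸m]≡n k≤h))) (sym (+-assoc r k _))

  mid+rest : ∀ r a → (r + ⌊ a /2⌋) + (a ∸ ⌊ a /2⌋) ≡ r + a
  mid+rest r a = sym (split-at r (⌊n/2⌋≤n a))

top⊆ : ∀ {r c h w k v} → k ≤ h → Inside (block r c k w) v → Inside (block r c h w) v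
top⊆ {r} k≤h (inside r< r≤ c< c≤) = inside r< (≤-trans r≤ (+-monoʳ-≤ r k≤h)) c< c≤

bottom⊆ : ∀ {r c h w k v} → k ≤ h → Inside (block (r + k) c (h ∸ k) w) v → Inside (block r c h w) v
bottom⊆ {r} k≤h (inside r< r≤ c< c≤) =
  inside (≤-<-trans (m≤m+n r _) r<) (≤-trans r≤ (≤-reflexive (sym (split-at r k≤h)))) c< c≤

left⊆ : ∀ {r c h w k v} → k ≤ w → Inside (block r c h k) v → Inside (block r c h w) v
left⊆ {c = c} k≤w (inside r< r≤ c< c≤) = inside r< r≤ c< (≤-trans c≤ (+-monoʳ-≤ c k≤w))

right⊆ : ∀ {r c h w k v} → k ≤ w → Inside (block r (c + k) h (w ∸ k)) v → Inside (block r c h w) v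
right⊆ {c = c} k≤w (inside r< r≤ c< c≤) =
  inside r< r≤ (≤-<-trans (m≤m+n c _) c<) (≤-trans c≤ (≤-reflexive (sym (split-at c k≤w))))

split-rows : ∀ {r c h w v} k → k ≤ h → Inside (block r c h w) v →
             Inside (block r c k w) v ⊎ Inside (block (r + k) c (h ∸ k) w) v
split-rows {r} {v = i , _} k k≤h (inside r< r≤ c< c≤) with i ≤? r + k
... | yes i≤ = inj₁ (inside r< i≤ c< c≤)
... | no  i≰ = inj₂ (inside (≰⇒> i≰) (≤-trans r≤ (≤-reflexive (split-at r k≤h))) c< c≤)

split-cols : ∀ {r c h w v} k → k ≤ w → Inside (block r c h w) v →
             Inside (block r c h k) v ⊎ Inside (block r (c + k) h (w ∸ k)) v
split-cols {c = c} {v = _ , j} k k≤w (inside r< r≤ c< c≤) with j ≤? c + k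
... | yes j≤ = inj₁ (inside r< r≤ c< j≤)
... | no  j≰ = inj₂ (inside r< r≤ (≰⇒> j≰) (≤-trans c≤ (≤-reflexive (split-at c k≤w))))

disjoint-rows : ∀ {r c c′ k h w w′ v} → Inside (block r c k w) v → Inside (block (r + k) c′ h w′) v → ⊥
disjoint-rows p q = ≤⇒≯ (Inside.row≤ p) (Inside.row< q)

disjoint-cols : ∀ {r r′ c k h h′ w v} → Inside (block r c h k) v → Inside (block r′ (c + k) h′ w) v → ⊥
disjoint-cols p q = ≤⇒≯ (Inside.col≤ p) (Inside.col< q)

Inside-quadrant : ∀ {B v} → Inside B v → Inside (child (quadrant B v) B) v
Inside-quadrant {block r c a b} {i , j} (inside r< r≤ c< c≤)
  with i ≤ᵇ r + ⌊ a /2⌋ | ≤ᵇ-reflects-≤ i (r + ⌊ a /2⌋) | j ≤ᵇ c + ⌊ b /2⌋ | ≤ᵇ-reflects-≤ j (c + ⌊ b /2⌋)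
... | true  | ofʸ i≤ | true  | ofʸ j≤ = inside r< i≤ c< j≤
... | false | ofⁿ i≰ | true  | ofʸ j≤ = inside (≰⇒> i≰) (≤-trans r≤ (≤-reflexive (sym (mid+rest r a)))) c< j≤
... | false | ofⁿ i≰ | false | ofⁿ j≰ = inside (≰⇒> i≰) (≤-trans r≤ (≤-reflexive (sym (mid+rest r a))))
                                               (≰⇒> j≰) (≤-trans c≤ (≤-reflexive (sym (mid+rest c b))))
... | true  | ofʸ i≤ | false | ofⁿ j≰ = inside r< i≤ (≰⇒> j≰) (≤-trans c≤ (≤-reflexive (sym (mid+rest c b))))

-- does (m ≤? n) computes to m ≤ᵇ n.
quadrant-child : ∀ q {B v} → Inside (child q B) v → quadrant B v ≡ q
quadrant-child tl {block r c a b} {i , j} (inside _ i≤ _ j≤)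
  rewrite dec-true (i ≤? r + ⌊ a /2⌋) i≤ | dec-true (j ≤? c + ⌊ b /2⌋) j≤ = refl
quadrant-child bl {block r c a b} {i , j} (inside i> _ _ j≤)
  rewrite dec-false (i ≤? r + ⌊ a /2⌋) (<⇒≱ i>) | dec-true (j ≤? c + ⌊ b /2⌋) j≤ = refl
quadrant-child br {block r c a b} {i , j} (inside i> _ j> _)
  rewrite dec-false (i ≤? r + ⌊ a /2⌋) (<⇒≱ i>) | dec-false (j ≤? c + ⌊ b /2⌋) (<⇒≱ j>) = refl
quadrant-child tr {block r c a b} {i , j} (inside _ i≤ j> _)
  rewrite dec-true (i ≤? r + ⌊ a /2⌋) i≤ | dec-false (j ≤? c + ⌊ b /2⌋) (<⇒≱ j>) = refl

centre∈child : ∀ {B} → 2 ≤ height B → 2 ≤ width B → ∀ q → Inside (child q B) (centre q B)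
centre∈child {block r c a b} 2≤a 2≤b tl =
  inside (m<m+n r (⌊n/2⌋-pos 2≤a)) ≤-refl (m<m+n c (⌊n/2⌋-pos 2≤b)) ≤-refl
centre∈child {block r c a b} 2≤a 2≤b bl =
  inside ≤-refl (m<m+n (r + _) (n∸⌊n/2⌋-pos 2≤a)) (m<m+n c (⌊n/2⌋-pos 2≤b)) ≤-refl
centre∈child {block r c a b} 2≤a 2≤b br =
  inside ≤-refl (m<m+n (r + _) (n∸⌊n/2⌋-pos 2≤a)) ≤-refl (m<m+n (c + _) (n∸⌊n/2⌋-pos 2≤b))
centre∈child {block r c a b} 2≤a 2≤b tr =
  inside (m<m+n r (⌊n/2⌋-pos 2≤a)) ≤-refl ≤-refl (m<m+n (c + _) (n∸⌊n/2⌋-pos 2≤b))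

child-halves : ∀ q B → 2 * height (child q B) ≤ suc (height B) × 2 * width (child q B) ≤ suc (width B)
child-halves tl (block r c a b) = 2*⌊n/2⌋≤1+n a , 2*⌊n/2⌋≤1+n b
child-halves bl (block r c a b) = 2*[n∸⌊n/2⌋]≤1+n a , 2*⌊n/2⌋≤1+n b
child-halves br (block r c a b) = 2*[n∸⌊n/2⌋]≤1+n a , 2*[n∸⌊n/2⌋]≤1+n b
child-halves tr (block r c a b) = 2*⌊n/2⌋≤1+n a , 2*[n∸⌊n/2⌋]≤1+n b

child-size< : ∀ {B} → 2 ≤ height B → 2 ≤ width B → ∀ q → size (child q B) < size B
child-size< {block r c a b} 2≤a 2≤b tl = +-mono-< (⌊n/2⌋-< 2≤a) (⌊n/2⌋-< 2≤b)
child-size< {block r c a b} 2≤a 2≤b bl = +-mono-< (n∸⌊n/2⌋-< 2≤a) (⌊n/2⌋-< 2≤b)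
child-size< {block r c a b} 2≤a 2≤b br = +-mono-< (n∸⌊n/2⌋-< 2≤a) (n∸⌊n/2⌋-< 2≤b)
child-size< {block r c a b} 2≤a 2≤b tr = +-mono-< (⌊n/2⌋-< 2≤a) (n∸⌊n/2⌋-< 2≤b)

child-size∸2-halves : ∀ q B → 2 * (size (child q B) ∸ 2) ≤ size B ∸ 2
child-size∸2-halves q B = begin
  2 * (size B′ ∸ 2)                  ≡⟨ *-distribˡ-∸ 2 (size B′) 2 ⟩
  2 * size B′ ∸ 4                    ≤⟨ ∸-monoˡ-≤ 4 2size≤ ⟩
  (size B + 2) ∸ 4                   ≡⟨ sym (∸-+-assoc (size B + 2) 2 2) ⟩
  (size B + 2) ∸ 2 ∸ 2               ≡⟨ cong (_∸ 2) (m+n∸n≡m (size B) 2) ⟩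
  size B ∸ 2                         ∎
  where
  open ≤-Reasoning
  B′ = child q B
  2size≤ : 2 * size B′ ≤ size B + 2
  2size≤ = begin
    2 * size B′                              ≡⟨ *-distribˡ-+ 2 (height B′) (width B′) ⟩
    2 * height B′ + 2 * width B′             ≤⟨ +-mono-≤ (proj₁ (child-halves q B)) (proj₂ (child-halves q B)) ⟩
    suc (height B) + suc (width B)           ≡⟨ cong suc (+-suc (height B) (width B)) ⟩
    suc (suc (size B))                       ≡⟨ +-comm 2 (size B) ⟩
    size B + 2                               ∎

child-size≤ : ∀ q B → size (child q B) ≤ size B
child-size≤ tl (block r c a b) = +-mono-≤ (⌊n/2⌋≤n a) (⌊n/2⌋≤n b)
child-size≤ bl (block r c a b) = +-mono-≤ (m∸n≤m a ⌊ a /2⌋) (⌊n/2⌋≤n b)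
child-size≤ br (block r c a b) = +-mono-≤ (m∸n≤m a ⌊ a /2⌋) (m∸n≤m b ⌊ b /2⌋)
child-size≤ tr (block r c a b) = +-mono-≤ (⌊n/2⌋≤n a) (m∸n≤m b ⌊ b /2⌋)

-- Stretch budgets

isLine : Block → Bool
isLine B = (width B ≡ᵇ 1) ∨ (height B ≡ᵇ 1)

-- β f B (u , v) is the bound on the tree path from u to v in tree f B, following the
-- recursion of specialTreeF (the order of the tests in isLine is the order of its clauses):
-- size B in a single row or column; otherwise the budget of the common quadrant of u and v,
-- or 4 · size B if they lie in different quadrants.
mutual
  β : ℕ → Block → Edge → ℕ
  β zero    _ _ = 0
  β (suc f) B e = if isLine B then size B else βrec f B e

  βrec : ℕ → Block → Edge → ℕ
  βrec f B (u , v) = βquadrants f B (quadrant B u) (quadrant B v) (u , v)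

  βquadrants : ℕ → Block → Quadrant → Quadrant → Edge → ℕ
  βquadrants f B q q′ e with q ≟Q q′
  ... | yes _ = β f (child q B) e
  ... | no  _ = 4 * size B

βrec-child : ∀ q {f B u v} → Inside (child q B) u → Inside (child q B) v →
             βrec f B (u , v) ≡ β f (child q B) (u , v)
βrec-child q pu pv rewrite quadrant-child q pu | quadrant-child q pv with q ≟Q q
... | yes _   = refl
... | no  q≢q = ⊥-elim (q≢q refl)

mutual
  β≤4*size : ∀ f B e → β f B e ≤ 4 * size B
  β≤4*size zero    _ _ = z≤n
  β≤4*size (suc f) B e with isLine B
  ... | true  = m≤n*m (size B) 4
  ... | false = βrec≤4*size f B e

  βrec≤4*size : ∀ f B e → βrec f B e ≤ 4 * size B
  βrec≤4*size f B (u , v) = βquadrants≤4*size f B (quadrant B u) (quadrant B v) (u , v)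

  βquadrants≤4*size : ∀ f B q q′ e → βquadrants f B q q′ e ≤ 4 * size B
  βquadrants≤4*size f B q q′ e with q ≟Q q′
  ... | yes _ = ≤-trans (β≤4*size f (child q B) e) (*-monoʳ-≤ 4 (child-size≤ q B))
  ... | no  _ = ≤-refl

child-pos : ∀ {B} → 2 ≤ height B → 2 ≤ width B → ∀ q → 1 ≤ height (child q B) × 1 ≤ width (child q B)
child-pos {block r c a b} 2≤a 2≤b tl = ⌊n/2⌋-pos 2≤a , ⌊n/2⌋-pos 2≤b
child-pos {block r c a b} 2≤a 2≤b bl = n∸⌊n/2⌋-pos 2≤a , ⌊n/2⌋-pos 2≤b
child-pos {block r c a b} 2≤a 2≤b br = n∸⌊n/2⌋-pos 2≤a , n∸⌊n/2⌋-pos 2≤b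
child-pos {block r c a b} 2≤a 2≤b tr = ⌊n/2⌋-pos 2≤a , n∸⌊n/2⌋-pos 2≤b

record SpecialTree (f : ℕ) (B : Block) : Set where
  field
    within    : ∀ {u v} → Adj (tree f B) u v → Inside B u × Inside B v
    reachable : ∀ {u v} → Inside B u → Inside B v → Reachable (Adj (tree f B)) u v
    diameter  : ∀ {u v} → Inside B u → Inside B v → PathBound (Adj (tree f B)) u v (4 * (size B ∸ 2) ∸ 3)
    stretch   : ∀ {u v} → Inside B u → Inside B v → PathBound (Adj (tree f B)) u v (β f B (u , v))

open SpecialTree

Adj-++⁻ : ∀ xs {ys u v} → Adj (xs ++ ys) u v → Adj xs u v ⊎ Adj ys u v
Adj-++⁻ xs (inj₁ e) with ∈-++⁻ xs e
... | inj₁ e′ = inj₁ (inj₁ e′)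
... | inj₂ e′ = inj₂ (inj₁ e′)
Adj-++⁻ xs (inj₂ e) with ∈-++⁻ xs e
... | inj₁ e′ = inj₁ (inj₂ e′)
... | inj₂ e′ = inj₂ (inj₂ e′)

Adj-++⁺ˡ : ∀ {xs ys u v} → Adj xs u v → Adj (xs ++ ys) u v
Adj-++⁺ˡ (inj₁ e) = inj₁ (∈-++⁺ˡ e)
Adj-++⁺ˡ (inj₂ e) = inj₂ (∈-++⁺ˡ e)

Adj-++⁺ʳ : ∀ xs {ys u v} → Adj ys u v → Adj (xs ++ ys) u v
Adj-++⁺ʳ xs (inj₁ e) = inj₁ (∈-++⁺ʳ xs e)
Adj-++⁺ʳ xs (inj₂ e) = inj₂ (∈-++⁺ʳ xs e)

module BridgeDiameter {R₁ R₂ : Graph} {S₁ S₂ : V → Set} (x y : V)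
  (closed₁ : ∀ {a b} → R₁ a b → S₁ a × S₁ b)
  (closed₂ : ∀ {a b} → R₂ a b → S₂ a × S₂ b)
  (disjoint : ∀ {a} → S₁ a → S₂ a → ⊥)
  (x∈S₁ : S₁ x) (y∈S₂ : S₂ y) {d : ℕ}
  (diam₁ : ∀ {u v} → S₁ u → S₁ v → PathBound R₁ u v d)
  (diam₂ : ∀ {u v} → S₂ u → S₂ v → PathBound R₂ u v d) where

  open Bridge x y closed₁ closed₂ disjoint x∈S₁ y∈S₂ public

  any : ∀ {u v} → S₁ u ⊎ S₂ u → S₁ v ⊎ S₂ v → PathBound R u v (d + suc d)
  any (inj₁ p) (inj₁ q) = bound₁₁ p q (PathBound-mono (m≤m+n d _) (diam₁ p q))
  any (inj₂ p) (inj₂ q) = bound₂₂ p q (PathBound-mono (m≤m+n d _) (diam₂ p q))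
  any (inj₁ p) (inj₂ q) = bound₁₂ p q (diam₁ p x∈S₁) (diam₂ y∈S₂ q)
  any (inj₂ p) (inj₁ q) = bound₂₁ p q (diam₂ p y∈S₂) (diam₁ x∈S₁ q)

  to-x : ∀ {u} → S₁ u ⊎ S₂ u → PathBound R u x (d + 1)
  to-x (inj₁ p) = bound₁₁ p x∈S₁ (PathBound-mono (m≤m+n d 1) (diam₁ p x∈S₁))
  to-x (inj₂ p) = bound₂₁ p x∈S₁ (diam₂ p y∈S₂) PathBound-refl

  from-x : ∀ {v} → S₁ v ⊎ S₂ v → PathBound R x v (d + 1)
  from-x (inj₁ q) = bound₁₁ x∈S₁ q (PathBound-mono (m≤m+n d 1) (diam₁ x∈S₁ q))
  from-x (inj₂ q) = PathBound-mono (≤-reflexive (+-comm 1 d)) (bound₁₂ x∈S₁ q PathBound-refl (diam₂ y∈S₂ q))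

  to-y : ∀ {u} → S₁ u ⊎ S₂ u → PathBound R u y (d + 1)
  to-y (inj₂ p) = bound₂₂ p y∈S₂ (PathBound-mono (m≤m+n d 1) (diam₂ p y∈S₂))
  to-y (inj₁ p) = bound₁₂ p y∈S₂ (diam₁ p x∈S₁) PathBound-refl

  from-y : ∀ {v} → S₁ v ⊎ S₂ v → PathBound R y v (d + 1)
  from-y (inj₂ q) = bound₂₂ y∈S₂ q (PathBound-mono (m≤m+n d 1) (diam₂ y∈S₂ q))
  from-y (inj₁ q) = PathBound-mono (≤-reflexive (+-comm 1 d)) (bound₂₁ y∈S₂ q PathBound-refl (diam₁ x∈S₁ q))

-- A simple path between the two halves of a block runs from its end to the middle edge within
-- one half (at most d + 1 edges), crosses it, and continues within the other half.
diameter-step : ∀ {e} → 2 ≤ e → let d = 4 * ⌊ e /2⌋ ∸ 3 in (d + 1) + suc (d + 1) ≤ 4 * e ∸ 3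
diameter-step {e} 2≤e = m+n≤o⇒m≤o∸n _ (begin
  (d + 1) + suc (d + 1) + 3  ≡⟨ double d ⟩
  2 * (d + 3)               ≡⟨ cong (2 *_) (m∸n+n≡m 3≤4h) ⟩
  2 * (4 * h)               ≡⟨ swap h ⟩
  4 * (2 * h)               ≤⟨ *-monoʳ-≤ 4 (2*⌊n/2⌋≤n e) ⟩
  4 * e                     ∎)
  where
  open ≤-Reasoning
  h = ⌊ e /2⌋
  d = 4 * h ∸ 3
  3≤4h : 3 ≤ 4 * h
  3≤4h = ≤-trans (n≤1+n 3) (*-monoʳ-≤ 4 (⌊n/2⌋-mono 2≤e))
  double : ∀ d → (d + 1) + suc (d + 1) + 3 ≡ 2 * (d + 3)
  double = solve-∀
  swap : ∀ h → 2 * (4 * h) ≡ 4 * (2 * h)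
  swap = solve-∀

module Split {f : ℕ} {B : Block} (tall : 2 ≤ height B) (wide : 2 ≤ width B)
             (ih : ∀ q → SpecialTree f (child q B)) where

  T : Quadrant → List Edge
  T q = tree f (child q B)

  links : List Edge
  links = (centre tl B , centre bl B) ∷ (centre bl B , centre br B) ∷ (centre br B , centre tr B) ∷ []

  -- The recursive clause of specialTreeF.
  glued : List Edge
  glued = T tl ++ T bl ++ T br ++ T tr ++ links

  In : Quadrant → V → Set
  In q = Inside (child q B)

  centre∈ : ∀ q → In q (centre q B)
  centre∈ = centre∈child tall wide

  e d : ℕ
  e = size B ∸ 2
  d = 4 * ⌊ e /2⌋ ∸ 3

  diam : ∀ q {u v} → In q u → In q v → PathBound (Adj (T q)) u v d
  diam q p p′ = PathBound-mono bound (diameter (ih q) p p′)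
    where
    bound : 4 * (size (child q B) ∸ 2) ∸ 3 ≤ d
    bound = ∸-monoˡ-≤ 3 (*-monoʳ-≤ 4 {size (child q B) ∸ 2} (2*m≤n⇒m≤⌊n/2⌋ (child-size∸2-halves q B)))

  module Left = BridgeDiameter (centre tl B) (centre bl B) (within (ih tl)) (within (ih bl))
                  disjoint-rows (centre∈ tl) (centre∈ bl) (diam tl) (diam bl)
  module Right = BridgeDiameter (centre br B) (centre tr B) (within (ih br)) (within (ih tr))
                  (λ p p′ → disjoint-rows p′ p) (centre∈ br) (centre∈ tr) (diam br) (diam tr)

  InLeft InRight : V → Set
  InLeft  = Inside (leftHalf B)
  InRight = Inside (rightHalf B)

  tl⊆left : ∀ {v} → In tl v → InLeft v
  tl⊆left = top⊆ (⌊n/2⌋≤n (height B))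
  bl⊆left : ∀ {v} → In bl v → InLeft v
  bl⊆left = bottom⊆ (⌊n/2⌋≤n (height B))
  br⊆right : ∀ {v} → In br v → InRight v
  br⊆right = bottom⊆ (⌊n/2⌋≤n (height B))
  tr⊆right : ∀ {v} → In tr v → InRight v
  tr⊆right = top⊆ (⌊n/2⌋≤n (height B))

  left-quadrant : ∀ {v} → InLeft v → In tl v ⊎ In bl v
  left-quadrant = split-rows _ (⌊n/2⌋≤n (height B))
  right-quadrant : ∀ {v} → InRight v → In br v ⊎ In tr v
  right-quadrant p = swap⊎ (split-rows _ (⌊n/2⌋≤n (height B)) p)
  half : ∀ {v} → Inside B v → InLeft v ⊎ InRight v
  half = split-cols _ (⌊n/2⌋≤n (width B))

  left-quadrant⁻ : ∀ {v} → In tl v ⊎ In bl v → InLeft v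
  left-quadrant⁻ = [ tl⊆left , bl⊆left ]
  right-quadrant⁻ : ∀ {v} → In br v ⊎ In tr v → InRight v
  right-quadrant⁻ = [ br⊆right , tr⊆right ]

  closedLeft : ∀ {a b} → Left.R a b → InLeft a × InLeft b
  closedLeft t = Product.map left-quadrant⁻ left-quadrant⁻ (Left.closed t)
  closedRight : ∀ {a b} → Right.R a b → InRight a × InRight b
  closedRight t = Product.map right-quadrant⁻ right-quadrant⁻ (Right.closed t)

  module Whole = Bridge {Left.R} {Right.R} (centre bl B) (centre br B) closedLeft closedRight
                   disjoint-cols (bl⊆left (centre∈ bl)) (br⊆right (centre∈ br))

  toWhole : ∀ {u v} → Adj glued u v → Whole.R u v
  toWhole t with Adj-++⁻ (T tl) t
  ... | inj₁ t₁ = inj₁ (inj₁ t₁)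
  ... | inj₂ t₁ with Adj-++⁻ (T bl) t₁
  ... | inj₁ t₂ = inj₁ (inj₂ (inj₁ t₂))
  ... | inj₂ t₂ with Adj-++⁻ (T br) t₂
  ... | inj₁ t₃ = inj₂ (inj₁ (inj₁ t₃))
  ... | inj₂ t₃ with Adj-++⁻ (T tr) t₃
  ... | inj₁ t₄ = inj₂ (inj₁ (inj₂ (inj₁ t₄)))
  ... | inj₂ (inj₁ (here refl))                 = inj₁ (inj₂ (inj₂ (inj₁ (refl , refl))))
  ... | inj₂ (inj₂ (here refl))                 = inj₁ (inj₂ (inj₂ (inj₂ (refl , refl))))
  ... | inj₂ (inj₁ (there (here refl)))         = inj₂ (inj₂ (inj₁ (refl , refl)))
  ... | inj₂ (inj₂ (there (here refl)))         = inj₂ (inj₂ (inj₂ (refl , refl)))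
  ... | inj₂ (inj₁ (there (there (here refl)))) = inj₂ (inj₁ (inj₂ (inj₂ (inj₁ (refl , refl)))))
  ... | inj₂ (inj₂ (there (there (here refl)))) = inj₂ (inj₁ (inj₂ (inj₂ (inj₂ (refl , refl)))))

  link : ∀ {u v} → Adj links u v → Adj glued u v
  link t = Adj-++⁺ʳ (T tl) (Adj-++⁺ʳ (T bl) (Adj-++⁺ʳ (T br) (Adj-++⁺ʳ (T tr) t)))

  fromWhole : ∀ {u v} → Whole.R u v → Adj glued u v
  fromWhole (inj₁ (inj₁ t))                         = Adj-++⁺ˡ t
  fromWhole (inj₁ (inj₂ (inj₁ t)))                  = Adj-++⁺ʳ (T tl) (Adj-++⁺ˡ t)
  fromWhole (inj₂ (inj₁ (inj₁ t)))                  = Adj-++⁺ʳ (T tl) (Adj-++⁺ʳ (T bl) (Adj-++⁺ˡ t))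
  fromWhole (inj₂ (inj₁ (inj₂ (inj₁ t))))           = Adj-++⁺ʳ (T tl) (Adj-++⁺ʳ (T bl) (Adj-++⁺ʳ (T br) (Adj-++⁺ˡ t)))
  fromWhole (inj₁ (inj₂ (inj₂ (inj₁ (refl , refl))))) = link (inj₁ (here refl))
  fromWhole (inj₁ (inj₂ (inj₂ (inj₂ (refl , refl))))) = link (inj₂ (here refl))
  fromWhole (inj₂ (inj₂ (inj₁ (refl , refl))))        = link (inj₁ (there (here refl)))
  fromWhole (inj₂ (inj₂ (inj₂ (refl , refl))))        = link (inj₂ (there (here refl)))
  fromWhole (inj₂ (inj₁ (inj₂ (inj₂ (inj₁ (refl , refl)))))) = link (inj₁ (there (there (here refl))))
  fromWhole (inj₂ (inj₁ (inj₂ (inj₂ (inj₂ (refl , refl)))))) = link (inj₂ (there (there (here refl))))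

  within′ : ∀ {u v} → Adj glued u v → Inside B u × Inside B v
  within′ t = Product.map inside-half inside-half (Whole.closed (toWhole t))
    where
    inside-half : ∀ {v} → InLeft v ⊎ InRight v → Inside B v
    inside-half = [ left⊆ (⌊n/2⌋≤n (width B)) , right⊆ (⌊n/2⌋≤n (width B)) ]

  reachable′ : ∀ {u v} → Inside B u → Inside B v → Reachable (Adj glued) u v
  reachable′ p p′ = Reachable-map fromWhole (Whole.reachable reachLeft reachRight (half p) (half p′))
    where
    reachLeft : ∀ {u v} → InLeft u → InLeft v → Reachable Left.R u v
    reachLeft p p′ = Left.reachable (reachable (ih tl)) (reachable (ih bl)) (left-quadrant p) (left-quadrant p′)
    reachRight : ∀ {u v} → InRight u → InRight v → Reachable Right.R u v
    reachRight p p′ = Right.reachable (reachable (ih br)) (reachable (ih tr)) (right-quadrant p) (right-quadrant p′)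

  diameter′ : ∀ {u v} → Inside B u → Inside B v → PathBound (Adj glued) u v (4 * e ∸ 3)
  diameter′ p p′ = PathBound-map toWhole (PathBound-mono (diameter-step 2≤e) (any (half p) (half p′)))
    where
    2≤e : 2 ≤ e
    2≤e = ∸-monoˡ-≤ 2 (+-mono-≤ tall wide)
    any : ∀ {u v} → InLeft u ⊎ InRight u → InLeft v ⊎ InRight v → PathBound Whole.R u v ((d + 1) + suc (d + 1))
    any (inj₁ p) (inj₁ p′) = Whole.bound₁₁ p p′ (PathBound-mono d+sd≤ (Left.any (left-quadrant p) (left-quadrant p′)))
      where d+sd≤ = +-mono-≤ (m≤m+n d 1) (s≤s (m≤m+n d 1))
    any (inj₂ p) (inj₂ p′) = Whole.bound₂₂ p p′ (PathBound-mono d+sd≤ (Right.any (right-quadrant p) (right-quadrant p′)))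
      where d+sd≤ = +-mono-≤ (m≤m+n d 1) (s≤s (m≤m+n d 1))
    any (inj₁ p) (inj₂ p′) = Whole.bound₁₂ p p′ (Left.to-y (left-quadrant p)) (Right.from-x (right-quadrant p′))
    any (inj₂ p) (inj₁ p′) = Whole.bound₂₁ p p′ (Right.to-x (right-quadrant p)) (Left.from-y (left-quadrant p′))

  lift : ∀ q {u v n} → In q u → In q v → PathBound (Adj (T q)) u v n → PathBound (Adj glued) u v n
  lift tl p p′ b = PathBound-map toWhole (Whole.bound₁₁ (tl⊆left p) (tl⊆left p′) (Left.bound₁₁ p p′ b))
  lift bl p p′ b = PathBound-map toWhole (Whole.bound₁₁ (bl⊆left p) (bl⊆left p′) (Left.bound₂₂ p p′ b))
  lift br p p′ b = PathBound-map toWhole (Whole.bound₂₂ (br⊆right p) (br⊆right p′) (Right.bound₁₁ p p′ b))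
  lift tr p p′ b = PathBound-map toWhole (Whole.bound₂₂ (tr⊆right p) (tr⊆right p′) (Right.bound₂₂ p p′ b))

  stretch′ : ∀ {u v} → Inside B u → Inside B v → PathBound (Adj glued) u v (βrec f B (u , v))
  stretch′ {u} {v} p p′ = by-quadrants (quadrant B u) (quadrant B v) (Inside-quadrant p) (Inside-quadrant p′)
    where
    by-quadrants : ∀ q q′ → In q u → In q′ v → PathBound (Adj glued) u v (βquadrants f B q q′ (u , v))
    by-quadrants q q′ pq pq′ with q ≟Q q′
    ... | yes refl = lift q pq pq′ (stretch (ih q) pq pq′)
    ... | no  _    = PathBound-mono (≤-trans (m∸n≤m _ 3) (*-monoʳ-≤ 4 (m∸n≤m (size B) 2))) (diameter′ p p′)

private
  offset : ∀ r {p a} → r < p → p ≤ r + a → ∃[ i ] (i < a × p ≡ r + suc i)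
  offset zero    {suc p} _        p≤a  = p , p≤a , refl
  offset (suc r) {suc p} (s≤s r<p) (s≤s p≤) with offset r r<p p≤
  ... | i , i< , refl = i , i< , refl

  offset⁺ : ∀ r {i a} → i < a → r < r + suc i × r + suc i ≤ r + a
  offset⁺ r {i} i<a = m<m+n r (s≤s z≤n) , +-monoʳ-≤ r i<a

  only : ∀ c {q} → c < q → q ≤ c + 1 → q ≡ suc c
  only c {q} c<q q≤ = ≤-antisym (subst (q ≤_) (+-comm c 1) q≤) c<q

  n≤4*n∸3 : ∀ n → n ≤ 4 * n ∸ 3
  n≤4*n∸3 zero    = z≤n
  n≤4*n∸3 (suc n) = m+n≤o⇒m≤o∸n (suc n) (+-monoʳ-≤ (suc n) (*-monoʳ-≤ 3 (s≤s (z≤n {n}))))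

column-tree : ∀ f r c a → SpecialTree (suc f) (block r c a 1)
column-tree f r c a = record
  { within    = Col.within
  ; reachable = Col.reachable
  ; diameter  = λ p p′ → PathBound-mono diam≤ (Col.diameter p p′)
  ; stretch   = λ p p′ → PathBound-mono (≤-trans (m∸n≤m a 1) (m≤m+n a 1)) (Col.diameter p p′)
  }
  where
  coords : ∀ {z} → Inside (block r c a 1) z → ∃[ i ] (i < a × z ≡ (r + suc i , suc c))
  coords (inside r< r≤ c< c≤) with offset r r< r≤ | only c c< c≤
  ... | i , i< , refl | refl = i , i< , refl
  vertex : ∀ {i} → i < a → Inside (block r c a 1) (r + suc i , suc c)
  vertex i< = inside (proj₁ (offset⁺ r i<)) (proj₂ (offset⁺ r i<)) ≤-refl (≤-reflexive (+-comm 1 c))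
  module Col = Line (λ i → r + suc i , suc c) a (Inside (block r c a 1)) coords vertex
  diam≤ : a ∸ 1 ≤ 4 * (a + 1 ∸ 2) ∸ 3
  diam≤ = subst (λ s → a ∸ 1 ≤ 4 * (s ∸ 2) ∸ 3) (+-comm 1 a) (n≤4*n∸3 (a ∸ 1))

row-tree : ∀ f r c b → SpecialTree (suc f) (block r c 1 (suc (suc b)))
row-tree f r c b = record
  { within    = Row.within
  ; reachable = Row.reachable
  ; diameter  = λ p p′ → PathBound-mono (n≤4*n∸3 (suc b)) (Row.diameter p p′)
  ; stretch   = λ p p′ → PathBound-mono (≤-trans (n≤1+n _) (n≤1+n _)) (Row.diameter p p′)
  }
  where
  B = block r c 1 (suc (suc b))
  coords : ∀ {z} → Inside B z → ∃[ j ] (j < suc (suc b) × z ≡ (suc r , c + suc j))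
  coords (inside r< r≤ c< c≤) with offset c c< c≤ | only r r< r≤
  ... | j , j< , refl | refl = j , j< , refl
  vertex : ∀ {j} → j < suc (suc b) → Inside B (suc r , c + suc j)
  vertex j< = inside ≤-refl (≤-reflexive (+-comm 1 r)) (proj₁ (offset⁺ c j<)) (proj₂ (offset⁺ c j<))
  module Row = Line (λ j → suc r , c + suc j) (suc (suc b)) (Inside B) coords vertex

specialTree-invariant : ∀ f B → 1 ≤ height B → 1 ≤ width B → size B ≤ f → SpecialTree f B
specialTree-invariant zero    (block _ _ (suc _) _) _ _ ()
specialTree-invariant (suc f) (block r c a 1) _ _ _ = column-tree f r c a
specialTree-invariant (suc f) (block r c 1 (suc (suc b))) _ _ _ = row-tree f r c b
specialTree-invariant (suc f) B@(block r c (suc (suc a)) (suc (suc b))) _ _ size≤ =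
  record { within = within′ ; reachable = reachable′ ; diameter = diameter′ ; stretch = stretch′ }
  where
  tall : 2 ≤ suc (suc a)
  tall = s≤s (s≤s z≤n)
  wide : 2 ≤ suc (suc b)
  wide = s≤s (s≤s z≤n)
  open Split {f} {B} tall wide (λ q → specialTree-invariant f (child q B)
    (proj₁ (child-pos tall wide q)) (proj₂ (child-pos tall wide q)) (≤-pred (≤-trans (child-size< tall wide q) size≤)))

-- Sums over ranges and over the edges of a block

sumRange : ℕ → ℕ → (ℕ → ℕ) → ℕ
sumRange k zero    g = 0
sumRange k (suc n) g = g k + sumRange (suc k) n g

sumRange-++ : ∀ k m n g → sumRange k (m + n) g ≡ sumRange k m g + sumRange (k + m) n g
sumRange-++ k zero    n g = cong (λ k′ → sumRange k′ n g) (sym (+-identityʳ k))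
sumRange-++ k (suc m) n g = begin
  g k + sumRange (suc k) (m + n) g                          ≡⟨ cong (g k +_) (sumRange-++ (suc k) m n g) ⟩
  g k + (sumRange (suc k) m g + sumRange (suc k + m) n g)   ≡⟨ sym (+-assoc (g k) _ _) ⟩
  sumRange k (suc m) g + sumRange (suc k + m) n g           ≡⟨ cong (λ k′ → sumRange k (suc m) g + sumRange k′ n g) (sym (+-suc k m)) ⟩
  sumRange k (suc m) g + sumRange (k + suc m) n g           ∎
  where open ≡-Reasoning

sumRange-cong : ∀ k n {g h} → (∀ i → k ≤ i → i < k + n → g i ≡ h i) → sumRange k n g ≡ sumRange k n h
sumRange-cong k zero    _  = refl
sumRange-cong k (suc n) eq = cong₂ _+_ (eq k ≤-refl (m<m+n k (s≤s z≤n)))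
  (sumRange-cong (suc k) n (λ i k< i< → eq i (<⇒≤ k<) (subst (i <_) (sym (+-suc k n)) i<)))

sumRange-≤ : ∀ k n {g} c → (∀ i → g i ≤ c) → sumRange k n g ≤ n * c
sumRange-≤ k zero    c g≤ = z≤n
sumRange-≤ k (suc n) c g≤ = +-mono-≤ (g≤ k) (sumRange-≤ (suc k) n c g≤)

sumRange-+ : ∀ k n g h → sumRange k n (λ i → g i + h i) ≡ sumRange k n g + sumRange k n h
sumRange-+ k zero    g h = refl
sumRange-+ k (suc n) g h = begin
  (g k + h k) + sumRange (suc k) n (λ i → g i + h i)   ≡⟨ cong (g k + h k +_) (sumRange-+ (suc k) n g h) ⟩
  (g k + h k) + (sumRange (suc k) n g + sumRange (suc k) n h) ≡⟨ +-interchange (g k) (h k) _ _ ⟩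
  sumRange k (suc n) g + sumRange k (suc n) h          ∎
  where
  open ≡-Reasoning
  +-interchange : ∀ a b c d → (a + b) + (c + d) ≡ (a + c) + (b + d)
  +-interchange = solve-∀

sumRange-const : ∀ {c} k n → sumRange k n (λ _ → c) ≡ n * c
sumRange-const k zero    = refl
sumRange-const k (suc n) = cong (_ +_) (sumRange-const (suc k) n)

sumRange-shift : ∀ k n g → sumRange (suc k) n g ≡ sumRange k n (g ∘ suc)
sumRange-shift k zero    g = refl
sumRange-shift k (suc n) g = cong (g (suc k) +_) (sumRange-shift (suc k) n g)

vEdge hEdge : ℕ → ℕ → Edge
vEdge i j = (i , j) , (suc i , j)
hEdge i j = (i , j) , (i , suc j)

verticalSum horizontalSum edgeSum : (Edge → ℕ) → Block → ℕ
verticalSum   g B = sumRange (suc (row B)) (height B ∸ 1) λ i → sumRange (suc (col B)) (width B) λ j → g (vEdge i j)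
horizontalSum g B = sumRange (suc (row B)) (height B) λ i → sumRange (suc (col B)) (width B ∸ 1) λ j → g (hEdge i j)
edgeSum       g B = verticalSum g B + horizontalSum g B

edgeSum-const : ∀ x B → edgeSum (λ _ → x) B ≡ (height B ∸ 1) * (width B * x) + height B * ((width B ∸ 1) * x)
edgeSum-const x B =
  trans (cong₂ _+_ (sumRange-cong _ (height B ∸ 1) (λ _ _ _ → sumRange-const _ (width B)))
                   (sumRange-cong _ (height B) (λ _ _ _ → sumRange-const _ (width B ∸ 1))))
        (cong₂ _+_ (sumRange-const _ (height B ∸ 1)) (sumRange-const _ (height B)))

private
  inner : ∀ {r a i} → suc r ≤ i → i < suc r + a → r < i × i ≤ r + a
  inner r< i< = r< , ≤-pred i<

  inner-pred : ∀ {r a i} → suc r ≤ i → i < suc r + (a ∸ 1) → r < i × suc i ≤ r + a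
  inner-pred {r} {zero}  r< i< rewrite +-identityʳ r = ⊥-elim (<⇒≱ i< r<)
  inner-pred {r} {suc a} {i} r< i< = r< , subst (suc i ≤_) (sym (+-suc r a)) i<

edgeSum-cong : ∀ {g h} B → (∀ {u v} → Inside B u → Inside B v → g (u , v) ≡ h (u , v)) → edgeSum g B ≡ edgeSum h B
edgeSum-cong B eq = cong₂ _+_
  (sumRange-cong _ (height B ∸ 1) λ i r< i< → sumRange-cong _ (width B) λ j c< j< →
     let (r<i , i<) = inner-pred r< i< ; (c<j , j≤) = inner c< j< in
     eq (inside r<i (<⇒≤ i<) c<j j≤) (inside (m<n⇒m<1+n r<i) i< c<j j≤))
  (sumRange-cong _ (height B) λ i r< i< → sumRange-cong _ (width B ∸ 1) λ j c< j< →
     let (r<i , i≤) = inner r< i< ; (c<j , j<) = inner-pred c< j< in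
     eq (inside r<i i≤ c<j (<⇒≤ j<)) (inside r<i i≤ (m<n⇒m<1+n c<j) j<))

private
  split-halves : ∀ k m₁ m₂ {n} → m₁ + m₂ ≡ n → ∀ g → sumRange k n g ≡ sumRange k m₁ g + sumRange (k + m₁) m₂ g
  split-halves k m₁ m₂ refl g = sumRange-++ k m₁ m₂ g

  split-around : ∀ k m₁ m₂ {n} → 1 ≤ m₁ → 1 ≤ m₂ → m₁ + m₂ ≡ n → ∀ g →
                 sumRange (suc k) (n ∸ 1) g ≡ sumRange (suc k) (m₁ ∸ 1) g + (g (k + m₁) + sumRange (suc (k + m₁)) (m₂ ∸ 1) g)
  split-around k (suc p) (suc q) _ _ refl g =
    trans (sumRange-++ (suc k) p (suc q) g) (cong (λ x → sumRange (suc k) p g + (g x + sumRange (suc x) q g)) (sym (+-suc k p)))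

  sumRange-ext : ∀ k n {g h} → (∀ i → g i ≡ h i) → sumRange k n g ≡ sumRange k n h
  sumRange-ext k n eq = sumRange-cong k n (λ i _ _ → eq i)

Σquadrants : (Quadrant → ℕ) → ℕ
Σquadrants F = F tl + F bl + F br + F tr

Σquadrants-cong : ∀ {F G} → (∀ q → F q ≡ G q) → Σquadrants F ≡ Σquadrants G
Σquadrants-cong eq = cong₂ _+_ (cong₂ _+_ (cong₂ _+_ (eq tl) (eq bl)) (eq br)) (eq tr)

Σquadrants-mono : ∀ {F G} → (∀ q → F q ≤ G q) → Σquadrants F ≤ Σquadrants G
Σquadrants-mono le = +-mono-≤ (+-mono-≤ (+-mono-≤ (le tl) (le bl)) (le br)) (le tr)

crossing : (Edge → ℕ) → Block → ℕ
crossing g B = sumRange (suc (col B)) (width B) (λ j → g (vEdge (midRow B) j))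
             + sumRange (suc (row B)) (height B) (λ i → g (hEdge i (midCol B)))

top bottom : (Edge → ℕ) → Block → ℕ
top    g B = sumRange (suc (row B)) ⌊ height B /2⌋ (λ i → g (hEdge i (midCol B)))
bottom g B = sumRange (suc (midRow B)) (height B ∸ ⌊ height B /2⌋) (λ i → g (hEdge i (midCol B)))

top+bottom : ∀ g B → sumRange (suc (row B)) (height B) (λ i → g (hEdge i (midCol B))) ≡ top g B + bottom g B
top+bottom g B = split-halves (suc (row B)) ⌊ height B /2⌋ _ (halves-sum (height B)) _

verticalSum-split : ∀ g B → 2 ≤ height B →
  verticalSum g B ≡ (verticalSum g (child tl B) + verticalSum g (child tr B))
                    + (sumRange (suc (col B)) (width B) (λ j → g (vEdge (midRow B) j))
                       + (verticalSum g (child bl B) + verticalSum g (child br B)))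
verticalSum-split g (block r c a b) 2≤a = begin
  sumRange (suc r) (a ∸ 1) full
    ≡⟨ split-around r ⌊ a /2⌋ (a ∸ ⌊ a /2⌋) (⌊n/2⌋-pos 2≤a) (n∸⌊n/2⌋-pos 2≤a) (halves-sum a) full ⟩
  sumRange (suc r) (⌊ a /2⌋ ∸ 1) full + (full (r + ⌊ a /2⌋) + sumRange (suc (r + ⌊ a /2⌋)) (a ∸ ⌊ a /2⌋ ∸ 1) full)
    ≡⟨ cong₂ (λ x y → x + (full (r + ⌊ a /2⌋) + y)) (halves (suc r) (⌊ a /2⌋ ∸ 1)) (halves _ (a ∸ ⌊ a /2⌋ ∸ 1)) ⟩
  _ ∎
  where
  open ≡-Reasoning
  full left right : ℕ → ℕ
  full   i = sumRange (suc c) b (λ j → g (vEdge i j))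
  left  i = sumRange (suc c) ⌊ b /2⌋ (λ j → g (vEdge i j))
  right i = sumRange (suc (c + ⌊ b /2⌋)) (b ∸ ⌊ b /2⌋) (λ j → g (vEdge i j))
  halves : ∀ k n → sumRange k n full ≡ sumRange k n left + sumRange k n right
  halves k n = trans (sumRange-ext k n λ i → split-halves (suc c) ⌊ b /2⌋ _ (halves-sum b) _) (sumRange-+ k n left right)

horizontalSum-split : ∀ g B → 2 ≤ width B →
  horizontalSum g B ≡ (horizontalSum g (child tl B) + (top g B + horizontalSum g (child tr B)))
                      + (horizontalSum g (child bl B) + (bottom g B + horizontalSum g (child br B)))
horizontalSum-split g (block r c a b) 2≤b =
  trans (split-halves (suc r) ⌊ a /2⌋ _ (halves-sum a) full)
        (cong₂ _+_ (thirds (suc r) ⌊ a /2⌋) (thirds (suc (r + ⌊ a /2⌋)) (a ∸ ⌊ a /2⌋)))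
  where
  full left right : ℕ → ℕ
  full   i = sumRange (suc c) (b ∸ 1) (λ j → g (hEdge i j))
  left  i = sumRange (suc c) (⌊ b /2⌋ ∸ 1) (λ j → g (hEdge i j))
  right i = sumRange (suc (c + ⌊ b /2⌋)) (b ∸ ⌊ b /2⌋ ∸ 1) (λ j → g (hEdge i j))
  middle : ℕ → ℕ
  middle i = g (hEdge i (c + ⌊ b /2⌋))
  thirds : ∀ k n → sumRange k n full ≡ sumRange k n left + (sumRange k n middle + sumRange k n right)
  thirds k n = begin
    sumRange k n full
      ≡⟨ sumRange-ext k n (λ i → split-around c ⌊ b /2⌋ _ (⌊n/2⌋-pos 2≤b) (n∸⌊n/2⌋-pos 2≤b) (halves-sum b) _) ⟩
    sumRange k n (λ i → left i + (middle i + right i))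
      ≡⟨ sumRange-+ k n left _ ⟩
    sumRange k n left + sumRange k n (λ i → middle i + right i)
      ≡⟨ cong (sumRange k n left +_) (sumRange-+ k n middle right) ⟩
    sumRange k n left + (sumRange k n middle + sumRange k n right) ∎
    where open ≡-Reasoning

edgeSum-split : ∀ g B → 2 ≤ height B → 2 ≤ width B →
                edgeSum g B ≡ Σquadrants (λ q → edgeSum g (child q B)) + crossing g B
edgeSum-split g B tall wide = begin
  verticalSum g B + horizontalSum g B
    ≡⟨ cong₂ _+_ (verticalSum-split g B tall) (horizontalSum-split g B wide) ⟩
  ((vs tl + vs tr) + (vm + (vs bl + vs br))) + ((hs tl + (top g B + hs tr)) + (hs bl + (bottom g B + hs br)))
    ≡⟨ regroup (vs tl) (vs tr) vm (vs bl) (vs br) (hs tl) (top g B) (hs tr) (hs bl) (bottom g B) (hs br) ⟩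
  Σquadrants (λ q → edgeSum g (child q B)) + (vm + (top g B + bottom g B))
    ≡⟨ cong (λ x → Σquadrants (λ q → edgeSum g (child q B)) + (vm + x)) (sym (top+bottom g B)) ⟩
  Σquadrants (λ q → edgeSum g (child q B)) + crossing g B ∎
  where
  open ≡-Reasoning
  vs hs : Quadrant → ℕ
  vs q = verticalSum g (child q B)
  hs q = horizontalSum g (child q B)
  vm = sumRange (suc (col B)) (width B) (λ j → g (vEdge (midRow B) j))
  regroup : ∀ vtl vtr vm vbl vbr htl ct htr hbl cb hbr →
            ((vtl + vtr) + (vm + (vbl + vbr))) + ((htl + (ct + htr)) + (hbl + (cb + hbr)))
            ≡ ((vtl + htl) + (vbl + hbl) + (vbr + hbr) + (vtr + htr)) + (vm + (ct + cb))
  regroup = solve-∀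

budget : ℕ → Block → ℕ
budget f B = edgeSum (β f B) B

budget-step : ∀ f B → 2 ≤ height B → 2 ≤ width B →
              edgeSum (βrec f B) B ≤ Σquadrants (λ q → budget f (child q B)) + 4 * (size B * size B)
budget-step f B tall wide = begin
  edgeSum (βrec f B) B
    ≡⟨ edgeSum-split (βrec f B) B tall wide ⟩
  Σquadrants (λ q → edgeSum (βrec f B) (child q B)) + crossing (βrec f B) B
    ≡⟨ cong (_+ crossing (βrec f B) B) (Σquadrants-cong λ q → edgeSum-cong (child q B) (βrec-child q {f})) ⟩
  Σquadrants (λ q → budget f (child q B)) + crossing (βrec f B) B
    ≤⟨ +-monoʳ-≤ (Σquadrants (λ q → budget f (child q B))) crossing≤ ⟩
  Σquadrants (λ q → budget f (child q B)) + 4 * (size B * size B) ∎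
  where
  open ≤-Reasoning
  crossing≤ : crossing (βrec f B) B ≤ 4 * (size B * size B)
  crossing≤ = begin
    crossing (βrec f B) B
      ≤⟨ +-mono-≤ (sumRange-≤ _ (width B) _ λ j → βrec≤4*size f B (vEdge (midRow B) j))
                 (sumRange-≤ _ (height B) _ λ i → βrec≤4*size f B (hEdge i (midCol B))) ⟩
    width B * (4 * size B) + height B * (4 * size B)
      ≡⟨ regroup (height B) (width B) ⟩
    4 * (size B * size B) ∎
    where
    regroup : ∀ h w → w * (4 * (h + w)) + h * (4 * (h + w)) ≡ 4 * ((h + w) * (h + w))
    regroup = solve-∀

private
  halves-differ : ∀ n → n ∸ ⌊ n /2⌋ ≡ ⌊ n /2⌋ ⊎ n ∸ ⌊ n /2⌋ ≡ suc ⌊ n /2⌋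
  halves-differ n = Sum.map (trans (n∸⌊n/2⌋≡⌈n/2⌉ n)) (trans (n∸⌊n/2⌋≡⌈n/2⌉ n)) (ceil n)
    where
    ceil : ∀ n → ⌈ n /2⌉ ≡ ⌊ n /2⌋ ⊎ ⌈ n /2⌉ ≡ suc ⌊ n /2⌋
    ceil zero          = inj₁ refl
    ceil (suc zero)    = inj₂ refl
    ceil (suc (suc n)) = Sum.map (cong suc) (cong suc) (ceil n)

  squares-of-halves : ∀ n → 2 * (⌊ n /2⌋ * ⌊ n /2⌋ + (n ∸ ⌊ n /2⌋) * (n ∸ ⌊ n /2⌋)) ≤ n * n + 1
  squares-of-halves n = subst (λ m → 2 * (x * x + y * y) ≤ m * m + 1) (halves-sum n) (balanced (halves-differ n))
    where
    x = ⌊ n /2⌋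
    y = n ∸ ⌊ n /2⌋
    even : ∀ x → 2 * (x * x + x * x) ≡ (x + x) * (x + x) + 0
    even = solve-∀
    odd : ∀ x → 2 * (x * x + suc x * suc x) ≡ (x + suc x) * (x + suc x) + 1
    odd = solve-∀
    balanced : y ≡ x ⊎ y ≡ suc x → 2 * (x * x + y * y) ≤ (x + y) * (x + y) + 1
    balanced (inj₁ y≡x) rewrite y≡x = ≤-trans (≤-reflexive (even x)) (+-monoʳ-≤ _ z≤n)
    balanced (inj₂ y≡x+1) rewrite y≡x+1 = ≤-reflexive (odd x)

squares-of-quadrants : ∀ B → Σquadrants (λ q → size (child q B) * size (child q B)) ≤ size B * size B + 2
squares-of-quadrants (block r c a b) = begin
  (a₁ + b₁) * (a₁ + b₁) + (a₂ + b₁) * (a₂ + b₁) + (a₂ + b₂) * (a₂ + b₂) + (a₁ + b₂) * (a₁ + b₂)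
    ≡⟨ expand a₁ a₂ b₁ b₂ ⟩
  2 * (a₁ * a₁ + a₂ * a₂) + 2 * (b₁ * b₁ + b₂ * b₂) + 2 * ((a₁ + a₂) * (b₁ + b₂))
    ≡⟨ cong₂ (λ x y → 2 * (a₁ * a₁ + a₂ * a₂) + 2 * (b₁ * b₁ + b₂ * b₂) + 2 * (x * y)) (halves-sum a) (halves-sum b) ⟩
  2 * (a₁ * a₁ + a₂ * a₂) + 2 * (b₁ * b₁ + b₂ * b₂) + 2 * (a * b)
    ≤⟨ +-monoˡ-≤ (2 * (a * b)) (+-mono-≤ (squares-of-halves a) (squares-of-halves b)) ⟩
  (a * a + 1) + (b * b + 1) + 2 * (a * b)
    ≡⟨ collect a b ⟩
  (a + b) * (a + b) + 2 ∎
  where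
  open ≤-Reasoning
  a₁ = ⌊ a /2⌋
  a₂ = a ∸ ⌊ a /2⌋
  b₁ = ⌊ b /2⌋
  b₂ = b ∸ ⌊ b /2⌋
  expand : ∀ a₁ a₂ b₁ b₂ →
    (a₁ + b₁) * (a₁ + b₁) + (a₂ + b₁) * (a₂ + b₁) + (a₂ + b₂) * (a₂ + b₂) + (a₁ + b₂) * (a₁ + b₂)
    ≡ 2 * (a₁ * a₁ + a₂ * a₂) + 2 * (b₁ * b₁ + b₂ * b₂) + 2 * ((a₁ + a₂) * (b₁ + b₂))
  expand = solve-∀
  collect : ∀ a b → (a * a + 1) + (b * b + 1) + 2 * (a * b) ≡ (a + b) * (a + b) + 2
  collect = solve-∀

private
  16≤4*s*s : ∀ {s} → 2 ≤ s → 16 ≤ 4 * (s * s)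
  16≤4*s*s 2≤s = *-monoʳ-≤ 4 (*-mono-≤ 2≤s 2≤s)

  leaf-step : ∀ {X} s {L} → X ≤ s * s → 2 ≤ s → 1 ≤ L → X + 16 * L ≤ 8 * (s * s) * L
  leaf-step {X} s {L} X≤ 2≤s 1≤L = begin
    X + 16 * L                                ≤⟨ +-mono-≤ (≤-trans X≤ (m≤m*n (s * s) L)) (*-monoˡ-≤ L (16≤4*s*s 2≤s)) ⟩
    s * s * L + 4 * (s * s) * L               ≤⟨ m≤m+n _ (3 * (s * s) * L) ⟩
    s * s * L + 4 * (s * s) * L + 3 * (s * s) * L ≡⟨ collect (s * s) L ⟩
    8 * (s * s) * L                           ∎
    where
    open ≤-Reasoning
    instance _ = >-nonZero 1≤L
    collect : ∀ t L → t * L + 4 * t * L + 3 * t * L ≡ 8 * t * L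
    collect = solve-∀

  recursion-step : ∀ {X Y} s {L} → X ≤ Y + 4 * (s * s) → Y + 64 * L ≤ 8 * (s * s + 2) * L → 2 ≤ s →
                   X + 16 * suc L ≤ 8 * (s * s) * suc L
  recursion-step {X} {Y} s {L} X≤ Y≤ 2≤s = +-cancelʳ-≤ (48 * L) _ _ (begin
    X + 16 * suc L + 48 * L                ≤⟨ +-monoˡ-≤ (48 * L) (+-monoˡ-≤ (16 * suc L) X≤) ⟩
    Y + 4 * t + 16 * suc L + 48 * L        ≡⟨ regroup Y t L ⟩
    (Y + 64 * L) + (4 * t + 16)            ≤⟨ +-mono-≤ Y≤ (+-monoʳ-≤ (4 * t) (16≤4*s*s 2≤s)) ⟩
    8 * (t + 2) * L + (4 * t + 4 * t)      ≡⟨ collect t L ⟩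
    8 * t * suc L + 16 * L                 ≤⟨ +-monoʳ-≤ (8 * t * suc L) (*-monoˡ-≤ L (m≤m+n 16 32)) ⟩
    8 * t * suc L + 48 * L                 ∎)
    where
    open ≤-Reasoning
    t = s * s
    regroup : ∀ Y t L → Y + 4 * t + 16 * suc L + 48 * L ≡ (Y + 64 * L) + (4 * t + 16)
    regroup = solve-∀
    collect : ∀ t L → 8 * (t + 2) * L + (4 * t + 4 * t) ≡ 8 * t * suc L + 16 * L
    collect = solve-∀

  log-child : ∀ {e e′ L} → 2 ≤ e → 2 * e′ ≤ e → ⌊log₂ e ⌋ < suc L → ⌊log₂ e′ ⌋ < L
  log-child {e} {e′} {L} 2≤e 2e′≤e log< = begin-strict
    ⌊log₂ e′ ⌋          ≤⟨ ⌊log₂⌋-mono-≤ (2*m≤n⇒m≤⌊n/2⌋ {e′} 2e′≤e) ⟩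
    ⌊log₂ ⌊ e /2⌋ ⌋     ≡⟨ ⌊log₂⌊n/2⌋⌋≡⌊log₂n⌋∸1 e ⟩
    ⌊log₂ e ⌋ ∸ 1       <⟨ pred< (≤-trans (s≤s z≤n) (⌊log₂⌋-mono-≤ 2≤e)) (≤-pred log<) ⟩
    L                   ∎
    where
    open ≤-Reasoning
    pred< : ∀ {x L} → 1 ≤ x → x ≤ L → x ∸ 1 < L
    pred< {suc x} _ x≤L = x≤L

  column-budget : ∀ x r c a → edgeSum (λ _ → x) (block r c a 1) ≤ (a + 1) * x
  column-budget x r c a = begin
    edgeSum (λ _ → x) (block r c a 1)    ≡⟨ edgeSum-const x (block r c a 1) ⟩
    (a ∸ 1) * (1 * x) + a * (0 * x)      ≡⟨ simplify (a ∸ 1) a x ⟩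
    (a ∸ 1) * x                          ≤⟨ *-monoˡ-≤ x (≤-trans (m∸n≤m a 1) (m≤m+n a 1)) ⟩
    (a + 1) * x                          ∎
    where
    open ≤-Reasoning
    simplify : ∀ y a x → y * (1 * x) + a * (0 * x) ≡ y * x
    simplify = solve-∀

  row-budget : ∀ x r c b → edgeSum (λ _ → x) (block r c 1 b) ≤ (1 + b) * x
  row-budget x r c b = begin
    edgeSum (λ _ → x) (block r c 1 b)    ≡⟨ edgeSum-const x (block r c 1 b) ⟩
    0 * (b * x) + 1 * ((b ∸ 1) * x)      ≡⟨ simplify (b ∸ 1) (b * x) x ⟩
    (b ∸ 1) * x                          ≤⟨ *-monoˡ-≤ x (≤-trans (m∸n≤m b 1) (n≤1+n b)) ⟩
    (1 + b) * x                          ∎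
    where
    open ≤-Reasoning
    simplify : ∀ y z x → 0 * z + 1 * (y * x) ≡ y * x
    simplify = solve-∀

-- The slack 16 · L pays for the + 2 of squares-of-quadrants at each of the L levels.
budget-bound : ∀ f B L → 1 ≤ height B → 1 ≤ width B → size B ≤ f → ⌊log₂ (size B ∸ 2) ⌋ < L →
               budget f B + 16 * L ≤ 8 * (size B * size B) * L
budget-bound zero    (block _ _ (suc _) _) _ _ _ () _
budget-bound (suc f) (block r c a 1) L 1≤a _ _ log< =
  leaf-step (a + 1) (column-budget (a + 1) r c a) (+-monoˡ-≤ 1 1≤a) (≤-trans (s≤s z≤n) log<)
budget-bound (suc f) (block r c 1 (suc (suc b))) L _ _ _ log< =
  leaf-step (3 + b) (row-budget (3 + b) r c (2 + b)) (s≤s (s≤s z≤n)) (≤-trans (s≤s z≤n) log<)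
budget-bound (suc f) B@(block r c (suc (suc a)) (suc (suc b))) (suc L) _ _ size≤ log< =
  recursion-step (size B) (budget-step f B tall wide) children (≤-trans tall (m≤m+n _ _))
  where
  tall : 2 ≤ suc (suc a)
  tall = s≤s (s≤s z≤n)
  wide : 2 ≤ suc (suc b)
  wide = s≤s (s≤s z≤n)
  sq : Block → ℕ
  sq B′ = size B′ * size B′
  child-bound : ∀ q → budget f (child q B) + 16 * L ≤ 8 * sq (child q B) * L
  child-bound q = budget-bound f (child q B) L (proj₁ (child-pos tall wide q)) (proj₂ (child-pos tall wide q))
    (≤-pred (≤-trans (child-size< tall wide q) size≤))
    (log-child {size B ∸ 2} {size (child q B) ∸ 2} (∸-monoˡ-≤ 2 (+-mono-≤ tall wide)) (child-size∸2-halves q B) log<)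
  children : Σquadrants (λ q → budget f (child q B)) + 64 * L ≤ 8 * (sq B + 2) * L
  children = begin
    Σquadrants (λ q → budget f (child q B)) + 64 * L
      ≡⟨ spread (budget f (child tl B)) (budget f (child bl B)) (budget f (child br B)) (budget f (child tr B)) L ⟩
    Σquadrants (λ q → budget f (child q B) + 16 * L)
      ≤⟨ Σquadrants-mono child-bound ⟩
    Σquadrants (λ q → 8 * sq (child q B) * L)
      ≡⟨ gather (sq (child tl B)) (sq (child bl B)) (sq (child br B)) (sq (child tr B)) L ⟩
    8 * Σquadrants (λ q → sq (child q B)) * L
      ≤⟨ *-monoˡ-≤ L (*-monoʳ-≤ 8 (squares-of-quadrants B)) ⟩
    8 * (sq B + 2) * L ∎
    where
    open ≤-Reasoning
    spread : ∀ x₁ x₂ x₃ x₄ L → x₁ + x₂ + x₃ + x₄ + 64 * L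
           ≡ (x₁ + 16 * L) + (x₂ + 16 * L) + (x₃ + 16 * L) + (x₄ + 16 * L)
    spread = solve-∀
    gather : ∀ x₁ x₂ x₃ x₄ L → 8 * x₁ * L + 8 * x₂ * L + 8 * x₃ * L + 8 * x₄ * L
           ≡ 8 * (x₁ + x₂ + x₃ + x₄) * L
    gather = solve-∀

-- The grid

totalStretch≤ : ∀ {ts gs} (g : Edge → ℕ) → All (λ e → (p : Path ts (proj₁ e) (proj₂ e)) → pathLength p ≤ g e) gs →
                (ps : TreePaths ts gs) → totalStretch ps ≤ sum (map g gs)
totalStretch≤ g []       []       = z≤n
totalStretch≤ g (b ∷ bs) (p ∷ ps) = +-mono-≤ (b p) (totalStretch≤ g bs ps)

private
  sum-map-applyUpTo : ∀ {A : Set} (g : A → ℕ) f n → sum (map g (applyUpTo f n)) ≡ sumRange 0 n (g ∘ f)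
  sum-map-applyUpTo g f zero    = refl
  sum-map-applyUpTo g f (suc n) =
    cong (g (f 0) +_) (trans (sum-map-applyUpTo g (f ∘ suc) n) (sym (sumRange-shift 0 n (g ∘ f))))

  sum-map-concatMap : ∀ {A : Set} (g : A → ℕ) (F : ℕ → List A) (f : ℕ → ℕ) n →
                      sum (map g (concatMap F (applyUpTo f n))) ≡ sumRange 0 n (λ i → sum (map g (F (f i))))
  sum-map-concatMap g F f zero    = refl
  sum-map-concatMap g F f (suc n) = begin
    sum (map g (F (f 0) ++ concatMap F (applyUpTo (f ∘ suc) n)))
      ≡⟨ cong sum (map-++ g (F (f 0)) _) ⟩
    sum (map g (F (f 0)) ++ map g (concatMap F (applyUpTo (f ∘ suc) n)))
      ≡⟨ sum-++ (map g (F (f 0))) _ ⟩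
    sum (map g (F (f 0))) + sum (map g (concatMap F (applyUpTo (f ∘ suc) n)))
      ≡⟨ cong (sum (map g (F (f 0))) +_) (trans (sum-map-concatMap g F (f ∘ suc) n) (sym (sumRange-shift 0 n _))) ⟩
    sumRange 0 (suc n) (λ i → sum (map g (F (f i)))) ∎
    where open ≡-Reasoning

  sum-rectangle : ∀ (g : Edge → ℕ) (e : ℕ → ℕ → Edge) m n →
                  sum (map g (concatMap (λ i → map (e i) (upTo n)) (upTo m)))
                  ≡ sumRange 0 m (λ i → sumRange 0 n (λ j → g (e i j)))
  sum-rectangle g e m n = begin
    sum (map g (concatMap (λ i → map (e i) (upTo n)) (upTo m)))
      ≡⟨ sum-map-concatMap g (λ i → map (e i) (upTo n)) id m ⟩
    sumRange 0 m (λ i → sum (map g (map (e i) (upTo n))))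
      ≡⟨ sumRange-cong 0 m (λ i _ _ → trans (cong (sum ∘ map g) (map-upTo (e i) n)) (sum-map-applyUpTo g (e i) n)) ⟩
    sumRange 0 m (λ i → sumRange 0 n (λ j → g (e i j))) ∎
    where open ≡-Reasoning

sum-gridEdges : ∀ (g : Edge → ℕ) n₁ n₂ → sum (map g (gridEdges n₁ n₂)) ≡ edgeSum g (block 0 0 n₁ n₂)
sum-gridEdges g n₁ n₂ = begin
  sum (map g (vertical ++ horizontal))                 ≡⟨ cong sum (map-++ g vertical horizontal) ⟩
  sum (map g vertical ++ map g horizontal)             ≡⟨ sum-++ (map g vertical) (map g horizontal) ⟩
  sum (map g vertical) + sum (map g horizontal)        ≡⟨ cong₂ _+_ (sum-rectangle g (λ i j → vEdge (suc i) (suc j)) (n₁ ∸ 1) n₂)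
                                                                (sum-rectangle g (λ i j → hEdge (suc i) (suc j)) n₁ (n₂ ∸ 1)) ⟩
  _                                                    ≡⟨ sym (cong₂ _+_ (shift₂ (n₁ ∸ 1) n₂ (λ i j → g (vEdge i j))) (shift₂ n₁ (n₂ ∸ 1) (λ i j → g (hEdge i j)))) ⟩
  edgeSum g (block 0 0 n₁ n₂)                          ∎
  where
  open ≡-Reasoning
  shift₂ : ∀ m n (h : ℕ → ℕ → ℕ) → sumRange 1 m (λ i → sumRange 1 n (h i)) ≡ sumRange 0 m (λ i → sumRange 0 n (h (suc i) ∘ suc))
  shift₂ m n h = trans (sumRange-shift 0 m _) (sumRange-cong 0 m (λ i _ _ → sumRange-shift 0 n (h (suc i))))
  vertical = concatMap (λ i → map (λ j → ((suc i , suc j) , (suc (suc i) , suc j))) (upTo n₂)) (upTo (n₁ ∸ 1))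
  horizontal = concatMap (λ i → map (λ j → ((suc i , suc j) , (suc i , suc (suc j)))) (upTo (n₂ ∸ 1))) (upTo n₁)

gridEdges-inside : ∀ n₁ n₂ → All (λ e → Inside (block 0 0 n₁ n₂) (proj₁ e) × Inside (block 0 0 n₁ n₂) (proj₂ e))
                                 (gridEdges n₁ n₂)
gridEdges-inside n₁ n₂ = All.++⁺
  (All.concat⁺ (All.map⁺ (All.applyUpTo⁺₁ id (n₁ ∸ 1) λ i< → All.map⁺ (All.applyUpTo⁺₁ id n₂ λ j< →
     inside (s≤s z≤n) (<⇒≤ (<∸1⇒suc< i<)) (s≤s z≤n) j< , inside (s≤s z≤n) (<∸1⇒suc< i<) (s≤s z≤n) j<))))
  (All.concat⁺ (All.map⁺ (All.applyUpTo⁺₁ id n₁ λ i< → All.map⁺ (All.applyUpTo⁺₁ id (n₂ ∸ 1) λ j< →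
     inside (s≤s z≤n) i< (s≤s z≤n) (<⇒≤ (<∸1⇒suc< j<)) , inside (s≤s z≤n) i< (s≤s z≤n) (<∸1⇒suc< j<)))))

length-gridEdges : ∀ n₁ n₂ → length (gridEdges n₁ n₂) ≡ (n₁ ∸ 1) * (n₂ * 1) + n₁ * ((n₂ ∸ 1) * 1)
length-gridEdges n₁ n₂ =
  trans (length≡sum-ones (gridEdges n₁ n₂)) (trans (sum-gridEdges (λ _ → 1) n₁ n₂) (edgeSum-const 1 (block 0 0 n₁ n₂)))
  where
  length≡sum-ones : ∀ {A : Set} (xs : List A) → length xs ≡ sum (map (λ _ → 1) xs)
  length≡sum-ones []       = refl
  length≡sum-ones (_ ∷ xs) = cong suc (length≡sum-ones xs)

vertices≤2*edges : ∀ n₁ n₂ → 1 ≤ n₁ → 1 ≤ n₂ → 2 ≤ n₁ * n₂ → n₁ * n₂ ≤ 2 * length (gridEdges n₁ n₂)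
vertices≤2*edges (suc p) (suc q) _ _ 2≤pq = subst (suc p * suc q ≤_) (cong (2 *_) (sym (length-gridEdges (suc p) (suc q))))
  (+-cancelʳ-≤ 1 _ _ (≤-trans (+-monoʳ-≤ (suc p * suc q) (positive p q 2≤pq)) (≤-reflexive (expand p q))))
  where
  positive : ∀ p q → 2 ≤ suc p * suc q → 1 ≤ 3 * p * q + (p + q)
  positive (suc p) q _ = ≤-trans (s≤s z≤n) (m≤n+m (suc p + q) (3 * suc p * q))
  positive zero (suc q) _ = s≤s z≤n
  positive zero zero (s≤s ())
  expand : ∀ p q → suc p * suc q + (3 * p * q + (p + q)) ≡ 2 * (p * (suc q * 1) + suc p * (q * 1)) + 1
  expand = solve-∀

module _ (n₁ n₂ : ℕ) (1≤n₁ : 1 ≤ n₁) (1≤n₂ : 1 ≤ n₂) where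

  private
    s = n₁ + n₂
    B = block 0 0 n₁ n₂
    T = specialTree-invariant s B 1≤n₁ 1≤n₂ ≤-refl

  gridTreePaths : GridTreePaths n₁ n₂
  gridTreePaths = All.map (λ (p , p′) → Reachable⇒Path (SpecialTree.reachable T p p′)) (gridEdges-inside n₁ n₂)

  totalStretch≤budget : (ps : GridTreePaths n₁ n₂) → totalStretch ps ≤ budget s B
  totalStretch≤budget ps = subst (totalStretch ps ≤_) (sum-gridEdges (β s B) n₁ n₂)
    (totalStretch≤ (β s B) (All.map (λ (p , p′) → PathBound⇒pathLength≤ (SpecialTree.stretch T p p′))
                                    (gridEdges-inside n₁ n₂)) ps)

  budget≤ : budget s B ≤ 8 * (s * s) * (2 * ⌊log₂ s ⌋)
  budget≤ = ≤-trans (m+n≤o⇒m≤o (budget s B) (budget-bound s B L 1≤n₁ 1≤n₂ ≤-refl ≤-refl)) (*-monoʳ-≤ (8 * (s * s)) L≤)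
    where
    L = suc ⌊log₂ (s ∸ 2) ⌋
    1≤lg : 1 ≤ ⌊log₂ s ⌋
    1≤lg = subst (_≤ ⌊log₂ s ⌋) (⌊log₂[2^n]⌋≡n 1) (⌊log₂⌋-mono-≤ (+-mono-≤ 1≤n₁ 1≤n₂))
    L≤ : L ≤ 2 * ⌊log₂ s ⌋
    L≤ = subst (L ≤_) (cong (⌊log₂ s ⌋ +_) (sym (+-identityʳ _))) (+-mono-≤ 1≤lg (⌊log₂⌋-mono-≤ (m∸n≤m s 2)))

proposition1 : ∃[ C ] ((n₁ n₂ : ℕ) → 1 ≤ n₁ → 1 ≤ n₂ → 2 ≤ n₁ * n₂ →
                 GridTreePaths n₁ n₂ ×
                 ((ps : GridTreePaths n₁ n₂) →
                   totalStretch ps * (n₁ * n₂)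
                     ≤ C * ((n₁ + n₂) ^ 2 * ⌊log₂ (n₁ + n₂) ⌋) * length (gridEdges n₁ n₂)))
proposition1 = 32 , λ n₁ n₂ 1≤n₁ 1≤n₂ 2≤n₁n₂ → gridTreePaths n₁ n₂ 1≤n₁ 1≤n₂ , λ ps → begin
  totalStretch ps * (n₁ * n₂)
    ≤⟨ *-mono-≤ (≤-trans (totalStretch≤budget n₁ n₂ 1≤n₁ 1≤n₂ ps) (budget≤ n₁ n₂ 1≤n₁ 1≤n₂))
                (vertices≤2*edges n₁ n₂ 1≤n₁ 1≤n₂ 2≤n₁n₂) ⟩
  8 * ((n₁ + n₂) * (n₁ + n₂)) * (2 * ⌊log₂ (n₁ + n₂) ⌋) * (2 * length (gridEdges n₁ n₂))
    ≡⟨ collect (n₁ + n₂) ⌊log₂ (n₁ + n₂) ⌋ (length (gridEdges n₁ n₂)) ⟩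
  32 * ((n₁ + n₂) ^ 2 * ⌊log₂ (n₁ + n₂) ⌋) * length (gridEdges n₁ n₂) ∎
  where
  open ≤-Reasoning
  -- s * (s * 1) is s ^ 2 unfolded.
  collect : ∀ s l m → 8 * (s * s) * (2 * l) * (2 * m) ≡ 32 * (s * (s * 1) * l) * m
  collect = solve-∀
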